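{- Let $(P,w)$ be a naturally labeled poset with $n$ elements, and let $\alpha$ be a composition of $n$. Then \[ \sum_{\sigma\in\mathcal{L}_\alpha(P,w)}(-1)^{|\mathrm{DES}(\sigma)\setminus S_\alpha|}=|\mathcal{L}^\ast_\alpha(P,w)|. \] In particular, the left-hand side is nonnegative.
   Context: For $\alpha=(\alpha_1,\dots,\alpha_\ell)\vDash n$: $S_\alpha=\{\alpha_1,\dots,\alpha_1+\dots+\alpha_{\ell-1}\}$ and blocks $B_i(\alpha)=\{\alpha_1+\dots+\alpha_{i-1}+1,\dots,\alpha_1+\dots+\alpha_i\}$. $\mathrm{DES}(\sigma)=\{i\in[n-1]:\sigma_i>\sigma_{i+1}\}$. A permutation $\sigma\in\mathfrak S_n$ is $\alpha$-unimodal if for each block $B_i(\alpha)=[a,b]$ there is $k\in[a,b]$ with $\sigma_a>\dots>\sigma_k<\dots<\sigma_b$. A labeled poset $(P,w)$ is a finite poset with a bijection $w:P\to[n]$; naturally labeled means $x<_Py\Rightarrow w(x)<w(y)$. $\mathcal{L}(P,w)=\{\sigma\in\mathfrak S_n:\sigma^{ -1}(w(x))<\sigma^{ -1}(w(y))\text{ whenever }x<_Py\}$. $\mathcal L_\alpha(P,w)$ is the set of $\alpha$-unimodal elements of $\mathcal L(P,w)$. For $\sigma\in\mathfrak S_n$, $P_i^\alpha(\sigma)=\{w^{ -1}(\sigma_j):j\in B_i(\alpha)\}$. $\mathcal{L}^\ast_\alpha(P,w)$ is the set of $\sigma\in\mathcal L_\alpha(P,w)$ such that every $P_i^\alpha(\sigma)$,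 with the induced order, has a unique minimal element. -}

module Defs where

open import Level using (Level; _⊔_) renaming (suc to lsuc)
open import Data.Bool using (Bool; true; false; _∧_; _∨_; not; if_then_else_)
open import Data.Nat using (ℕ; zero; suc; _+_; _∸_; _<ᵇ_; _≡ᵇ_; _<_)
open import Data.Fin using (Fin; toℕ)
open import Data.Fin.Properties using () renaming (_≟_ to _≟ᶠ_)
open import Data.Nat.ListAction using (sum)
open import Data.Bool.ListAction using (all; any)
open import Data.List using (List; []; _∷_; length; map; filterᵇ; applyUpTo; foldr; concatMap; mapMaybe; allFin)
open import Data.List.Relation.Unary.All using (All)
open import Data.Maybe using (Maybe; just; nothing)
open import Data.Product using (_×_; _,_)
open import Data.Integer using (ℤ; _^_; -1ℤ; 0ℤ) renaming (_+_ to _+ℤ_)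
open import Relation.Binary.Bundles using (DecPoset)
open import Relation.Binary.PropositionalEquality using (_≡_)
import Relation.Binary.PropositionalEquality as ≡
open import Function.Bundles using (Inverse)
open import Relation.Nullary using (¬_)
open import Relation.Nullary.Decidable using (⌊_⌋)

-- The label set [n] = {1,…,n} is modelled by
-- Fin n, with label k+1 represented by the element of Fin n with toℕ = k.

record LabeledPoset (n : ℕ) (c ℓ₁ ℓ₂ : Level) : Set (lsuc (c ⊔ ℓ₁ ⊔ ℓ₂)) where
  field
    P : DecPoset c ℓ₁ ℓ₂
    w : Inverse (DecPoset.Eq.setoid P) (≡.setoid (Fin n))
  open DecPoset P public
  open Inverse w public using (to; from)

  _<P_ : Carrier → Carrier → Set (ℓ₁ ⊔ ℓ₂)
  x <P y = (x ≤ y) × ¬ (x ≈ y)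

  _<Pᵇ_ : Carrier → Carrier → Bool
  x <Pᵇ y = ⌊ x ≤? y ⌋ ∧ not ⌊ x ≟ y ⌋

module _ {n : ℕ} {c ℓ₁ ℓ₂ : Level} where

  NaturallyLabeled : LabeledPoset n c ℓ₁ ℓ₂ → Set (c ⊔ ℓ₁ ⊔ ℓ₂)
  NaturallyLabeled L = ∀ x y → x <P y → toℕ (to x) < toℕ (to y)
    where open LabeledPoset L

record Composition (n : ℕ) : Set where
  field
    parts    : List ℕ
    positive : All (λ k → 0 < k) parts
    sums     : sum parts ≡ n
open Composition public

-- the integer interval [a , b] = {a, …, b} (empty if b < a)
range : ℕ → ℕ → List ℕ
range a b = applyUpTo (λ t → a + t) (suc b ∸ a)

_∈ᵇ_ : ℕ → List ℕ → Bool
i ∈ᵇ xs = any (i ≡ᵇ_) xs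

-- S_α = {α₁, α₁+α₂, …, α₁+⋯+α_{ℓ-1}}, computed from an offset
partialSums : ℕ → List ℕ → List ℕ
partialSums off []           = []
partialSums off (k ∷ [])     = []
partialSums off (k ∷ k' ∷ ks) = (off + k) ∷ partialSums (off + k) (k' ∷ ks)

S : ∀ {n} → Composition n → List ℕ
S α = partialSums 0 (parts α)

-- the blocks B_i(α) = [α₁+⋯+α_{i-1}+1 , α₁+⋯+α_i], as pairs (a , b)
blocksFrom : ℕ → List ℕ → List (ℕ × ℕ)
blocksFrom off []       = []
blocksFrom off (k ∷ ks) = (suc off , off + k) ∷ blocksFrom (off + k) ks

blocks : ∀ {n} → Composition n → List (ℕ × ℕ)
blocks α = blocksFrom 0 (parts α)

-- Permutations of [n] in one-line notation σ = σ₁ σ₂ … σₙ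

words : (n k : ℕ) → List (List (Fin n))
words n zero    = [] ∷ []
words n (suc k) = concatMap (λ v → map (v ∷_) (words n k)) (allFin n)

distinctᵇ : ∀ {n} → List (Fin n) → Bool
distinctᵇ []       = true
distinctᵇ (x ∷ xs) = not (any (λ y → ⌊ x ≟ᶠ y ⌋) xs) ∧ distinctᵇ xs

Sym : (n : ℕ) → List (List (Fin n))
Sym n = filterᵇ distinctᵇ (words n n)

-- σ_i (1-indexed), as a label
letter : ∀ {n} → List (Fin n) → ℕ → Maybe (Fin n)
letter []       i             = nothing
letter (x ∷ xs) zero          = nothing
letter (x ∷ xs) (suc zero)    = just x
letter (x ∷ xs) (suc (suc i)) = letter xs (suc i)

-- σ_i as a number in [n] (0 outside the range 1..n, never used there)
val : ∀ {n} → List (Fin n) → ℕ → ℕ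
val σ i with letter σ i
... | just v  = suc (toℕ v)
... | nothing = 0

-- σ⁻¹(v): the position (1-indexed) of the letter v in σ
posOf : ∀ {n} → List (Fin n) → Fin n → ℕ
posOf []       v = 0
posOf (x ∷ xs) v = if ⌊ x ≟ᶠ v ⌋ then 1 else suc (posOf xs v)

DES : ∀ {n} → List (Fin n) → List ℕ
DES {n} σ = filterᵇ (λ i → val σ (suc i) <ᵇ val σ i) (range 1 (n ∸ 1))

desNotInS : ∀ {n} → Composition n → List (Fin n) → ℕ
desNotInS α σ = length (filterᵇ (λ i → not (i ∈ᵇ S α)) (DES σ))

unimodalOnᵇ : ∀ {n} → List (Fin n) → ℕ × ℕ → Bool
unimodalOnᵇ σ (a , b) =
  any (λ k → all (λ j → val σ (suc j) <ᵇ val σ j) (range a (k ∸ 1))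
           ∧ all (λ j → val σ j <ᵇ val σ (suc j)) (range k (b ∸ 1)))
      (range a b)

unimodalᵇ : ∀ {n} → Composition n → List (Fin n) → Bool
unimodalᵇ α σ = all (unimodalOnᵇ σ) (blocks α)

module _ {n : ℕ} {c ℓ₁ ℓ₂ : Level} (L : LabeledPoset n c ℓ₁ ℓ₂) where
  open LabeledPoset L

  -- σ ∈ 𝓛(P,w): σ⁻¹(w(x)) < σ⁻¹(w(y)) whenever x <_P y
  -- (x, y range over P via their labels: x = w⁻¹(i), y = w⁻¹(j))
  linExtᵇ : List (Fin n) → Bool
  linExtᵇ σ = all (λ i → all (λ j →
                 not (from i <Pᵇ from j) ∨ (posOf σ i <ᵇ posOf σ j))
               (allFin n)) (allFin n)

  𝓛 : List (List (Fin n))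
  𝓛 = filterᵇ linExtᵇ (Sym n)

  𝓛α : Composition n → List (List (Fin n))
  𝓛α α = filterᵇ (unimodalᵇ α) 𝓛

  Pblock : List (Fin n) → ℕ × ℕ → List Carrier
  Pblock σ (a , b) = map from (mapMaybe (letter σ) (range a b))

  -- a finite subset (given as a list of distinct elements) has a unique
  -- minimal element in the induced order
  uniqueMinᵇ : List Carrier → Bool
  uniqueMinᵇ Q = length (filterᵇ (λ m → not (any (λ m' → m' <Pᵇ m) Q)) Q) ≡ᵇ 1

  𝓛⋆α : Composition n → List (List (Fin n))
  𝓛⋆α α = filterᵇ (λ σ → all (λ B → uniqueMinᵇ (Pblock σ B)) (blocks α)) (𝓛α α)

  signedSum : Composition n → ℤ
  signedSum α = foldr (λ σ acc → (-1ℤ ^ desNotInS α σ) +ℤ acc) 0ℤ (𝓛α α)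

module Submission where

-- Proof by a sign-reversing involution ι on 𝓛_α(P,w) fixing exactly 𝓛*_α(P,w).
-- Cut σ into its α-blocks.  A unimodal block is a valley L ++ m ∷ R (L ++ [m]
-- decreasing, m ∷ R increasing); its |L| descents are exactly the descents of σ
-- inside the block, i.e. those outside S_α.  As σ is a linear extension and w is
-- natural, m and every letter of L are minimal in the block's subposet.  So if
-- every block has a unique minimal element, all L are empty and σ is a fixed
-- point of sign +1.  Otherwise ι toggles the first block with a second minimal
-- element: the one of least label, e, moves from the end of L into R or from R
-- to the end of L; this changes the descents by one and is undone by ι.

open import Level using (Level)
open import Data.Bool using (Bool; true; false; T; T?; not; _∧_; _∨_; if_then_else_)
open import Data.Bool.Properties using (T-∧; T-∨; T-≡; ∧-assoc; ∧-identityʳ; ∧-zeroʳ)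
open import Data.Bool.ListAction using (all; any; and; or)
open import Data.Unit using (tt)
open import Data.Nat using (ℕ; zero; suc; _+_; _∸_; s≤s; z≤n; _<ᵇ_; _≡ᵇ_)
open import Data.Nat.Properties
  using ( +-assoc; +-cancelˡ-≡; +-comm; +-identityʳ; +-monoʳ-≤; +-suc; <-asym; <-cmp; <-irrefl; <-trans
        ; <ᵇ⇒<; <⇒<ᵇ; <⇒≢; <⇒≤; <⇒≯; <⇒≱; [m+n]∸[m+o]≡n∸o; m+n∸m≡n; m<m+n; m≤m+n; suc-injective
        ; ∸-+-assoc; ≡ᵇ⇒≡; ≡⇒≡ᵇ; ≤-<-trans; ≤-antisym; ≤-pred; ≤-refl; ≤-trans; ≤∧≢⇒<; ≮⇒≥ )
open import Data.Nat.ListAction using (sum)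
open import Data.Nat.ListAction.Properties using (sum-++)
open import Data.Integer using (ℤ; 0ℤ; 1ℤ; -1ℤ; -_; _^_) renaming (_+_ to _+ℤ_)
import Data.Integer.Properties as ℤ
open import Data.Fin using (Fin; toℕ)
open import Data.Fin.Properties using (toℕ-injective) renaming (_≟_ to _≟ᶠ_)
open import Data.Maybe using (Maybe; just; nothing; maybe)
open import Data.Product using (_×_; _,_; proj₁; proj₂; ∃)
open import Data.Sum using (_⊎_; inj₁; inj₂)
open import Data.List
  using ( List; []; _∷_; [_]; _++_; length; map; filter; filterᵇ; foldr; concat; take; drop
        ; applyUpTo; upTo; allFin; mapMaybe; catMaybes )
open import Data.List.Properties
  using ( length-++; length-tabulate; ++-assoc; map-++; map-∘; map-cong; concat-++; filter-++; filter-all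
        ; filter-notAll; filter-accept; filter-reject; take++drop≡id; ∷-injectiveˡ; ∷-injectiveʳ; ≡-dec )
open import Data.List.Membership.Propositional using (_∈_; _∉_; lose)
open import Data.List.Membership.Propositional.Properties
  using (∈-filter⁺; ∈-filter⁻; ∈-map⁺; ∈-map⁻; ∈-concat⁺′; ∈-concat⁻′; ∈-allFin; ∈-++⁻; ∈-++⁺ˡ; ∈-++⁺ʳ)
import Data.List.Membership.DecPropositional as DecMembership
open import Data.List.Relation.Unary.Any as Any using (here; there)
open import Data.List.Relation.Unary.Any.Properties using (any⁺; any⁻)
open import Data.List.Relation.Unary.All as All using (All; []; _∷_)
import Data.List.Relation.Unary.All.Properties as AllP
open import Data.List.Relation.Unary.All.Properties using (¬Any⇒All¬; All¬⇒¬Any)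
open import Data.List.Relation.Unary.AllPairs as AllPairs using (AllPairs; []; _∷_)
import Data.List.Relation.Unary.AllPairs.Properties as AllPairsP
open import Data.List.Relation.Unary.Unique.Propositional using (Unique)
import Data.List.Relation.Unary.Unique.Propositional.Properties as UniqueP
open import Data.List.Relation.Unary.Unique.Propositional.Properties using (Unique[x∷xs]⇒x∉xs)
open import Data.List.Relation.Binary.Subset.Propositional using (_⊆_)
open import Data.List.Relation.Binary.Permutation.Propositional using (_↭_; ↭-refl; ↭-sym; ↭-trans; prep; swap; ↭⇒↭ₛ)
import Data.List.Relation.Binary.Permutation.Propositional.Properties as ↭
import Data.List.Relation.Binary.Permutation.Setoid.Properties as ↭ₛ
open import Function using (_∘_; id)
open import Function.Bundles using (Equivalence; Inverse)
open import Relation.Binary.Definitions using (DecidableEquality; tri<; tri≈; tri>)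
open import Relation.Binary.PropositionalEquality hiding ([_])
open import Relation.Nullary using (¬_; ¬?; yes; no; does; contradiction)
open import Relation.Nullary.Decidable using (⌊_⌋; toWitness; fromWitness; dec-true; dec-false)
open import Defs

-- The orders of ℕ are opened inside each module that uses them, so that at top
-- level _≤_ is the order of ℤ in which theorem2p7 is stated.

module Removal {X : Set} (_≟_ : DecidableEquality X) where

  open import Data.Nat using (_≤_; _<_)

  remove : X → List X → List X
  remove y = filter (λ z → ¬? (z ≟ y))

  ∈-remove⁻ : ∀ {x y} l → x ∈ remove y l → x ∈ l × x ≢ y
  ∈-remove⁻ l = ∈-filter⁻ _ {xs = l}

  ∈-remove⁺ : ∀ {x y l} → x ∈ l → x ≢ y → x ∈ remove y l
  ∈-remove⁺ = ∈-filter⁺ _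

  remove-∉ : ∀ {y} l → y ∉ l → remove y l ≡ l
  remove-∉ l y∉l = filter-all _ (All.map (λ y≢z z≡y → y≢z (sym z≡y)) (¬Any⇒All¬ l y∉l))

  length-remove : ∀ {y l} → y ∈ l → length (remove y l) < length l
  length-remove {l = l} y∈l = filter-notAll _ l (Any.map (λ y≡z z≢y → z≢y (sym y≡z)) y∈l)

  unique-remove : ∀ {y l} → Unique l → Unique (remove y l)
  unique-remove = UniqueP.filter⁺ _

  remove-↭ : ∀ e R → e ∈ R → Unique R → R ↭ e ∷ remove e R
  remove-↭ e (x ∷ R) (here refl) u with x ≟ x
  ... | yes _  rewrite remove-∉ R (Unique[x∷xs]⇒x∉xs u) = ↭-refl
  ... | no x≢x = contradiction refl x≢x
  remove-↭ e (x ∷ R) (there e∈) (x∉ ∷ u) with x ≟ e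
  ... | yes refl = contradiction e∈ (Unique[x∷xs]⇒x∉xs (x∉ ∷ u))
  ... | no _     = ↭-trans (prep x (remove-↭ e R e∈ u)) (swap x e ↭-refl)

  remove-last : ∀ e L → e ∉ L → remove e (L ++ [ e ]) ≡ L
  remove-last e []      _ with e ≟ e
  ... | yes _  = refl
  ... | no e≢e = contradiction refl e≢e
  remove-last e (x ∷ L) e∉ with x ≟ e
  ... | yes refl = contradiction (here refl) e∉
  ... | no _     = cong (x ∷_) (remove-last e L (e∉ ∘ there))

  remove-other : ∀ e x R → x ≢ e → remove e (x ∷ R) ≡ x ∷ remove e R
  remove-other e x R x≢e with x ≟ e
  ... | yes x≡e = contradiction x≡e x≢e
  ... | no _    = refl

  Unique-↭ : ∀ {xs ys : List X} → xs ↭ ys → Unique xs → Unique ys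
  Unique-↭ p = ↭ₛ.Unique-resp-↭ (setoid X) (↭⇒↭ₛ p)

  unique-⊆-length : ∀ {xs ys} → Unique xs → xs ⊆ ys → length xs ≤ length ys
  unique-⊆-length {[]} _ _ = z≤n
  unique-⊆-length {x ∷ xs} {ys} (x∉xs ∷ u) xs⊆ys =
    ≤-trans (s≤s (unique-⊆-length u tail⊆)) (length-remove (xs⊆ys (here refl)))
    where
      tail⊆ : xs ⊆ remove x ys
      tail⊆ z∈xs = ∈-remove⁺ (xs⊆ys (there z∈xs)) (λ z≡x → All.lookup x∉xs z∈xs (sym z≡x))

module SignReversingInvolution {X : Set} (_≟_ : DecidableEquality X)
  (sign : X → ℤ) (fixed? : X → Bool) (ι : X → X) where

  open import Data.Nat using (_≤_)
  open import Data.Integer using (+_)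

  open Removal _≟_

  Σsign : List X → ℤ
  Σsign = foldr (λ x acc → sign x +ℤ acc) 0ℤ

  #fixed : List X → ℕ
  #fixed l = length (filterᵇ fixed? l)

  record IsSignReversing (l : List X) : Set where
    field
      closed     : ∀ {x} → x ∈ l → ι x ∈ l
      involutive : ∀ {x} → x ∈ l → ι (ι x) ≡ x
      onFixed    : ∀ {x} → x ∈ l → fixed? x ≡ true → ι x ≡ x × sign x ≡ 1ℤ
      onMoved    : ∀ {x} → x ∈ l → fixed? x ≡ false → ι x ≢ x × sign (ι x) ≡ - sign x

  restrict : ∀ {l l'} → l' ⊆ l → (∀ {x} → x ∈ l' → ι x ∈ l')
           → IsSignReversing l → IsSignReversing l'
  restrict l'⊆l cl' isr = record
    { closed = cl' ; involutive = involutive ∘ l'⊆l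
    ; onFixed = onFixed ∘ l'⊆l ; onMoved = onMoved ∘ l'⊆l }
    where open IsSignReversing isr

  Σsign-remove : ∀ {y} l → Unique l → y ∈ l → Σsign l ≡ sign y +ℤ Σsign (remove y l)
  Σsign-remove {y} (z ∷ l) (z∉l ∷ u) (here refl)
    rewrite filter-reject (λ z → ¬? (z ≟ y)) {xs = l} (λ ne → ne refl)
          | remove-∉ l (Unique[x∷xs]⇒x∉xs (z∉l ∷ u)) = refl
  Σsign-remove {y} (z ∷ l) (z∉l ∷ u) (there y∈l)
    rewrite filter-accept (λ z → ¬? (z ≟ y)) {xs = l} (λ z≡y → All.lookup z∉l y∈l z≡y) =
    begin
      sign z +ℤ Σsign l                                ≡⟨ cong (sign z +ℤ_) (Σsign-remove l u y∈l) ⟩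
      sign z +ℤ (sign y +ℤ Σsign (remove y l))         ≡⟨ sym (ℤ.+-assoc (sign z) _ _) ⟩
      (sign z +ℤ sign y) +ℤ Σsign (remove y l)         ≡⟨ cong (_+ℤ Σsign (remove y l)) (ℤ.+-comm (sign z) (sign y)) ⟩
      (sign y +ℤ sign z) +ℤ Σsign (remove y l)         ≡⟨ ℤ.+-assoc (sign y) _ _ ⟩
      sign y +ℤ (sign z +ℤ Σsign (remove y l))         ∎
    where open ≡-Reasoning

  #fixed-remove : ∀ {y} l → fixed? y ≡ false → #fixed (remove y l) ≡ #fixed l
  #fixed-remove [] _ = refl
  #fixed-remove {y} (z ∷ l) fy with z ≟ y
  ... | yes refl rewrite fy = #fixed-remove l fy
  ... | no _ with fixed? z
  ...   | true  = cong suc (#fixed-remove l fy)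
  ...   | false = #fixed-remove l fy

  module _ {x l} (x∉l : x ∉ l) (isr : IsSignReversing (x ∷ l)) where

    open IsSignReversing isr

    private
      ι-injective : ∀ {y z} → y ∈ x ∷ l → z ∈ x ∷ l → ι y ≡ ι z → y ≡ z
      ι-injective y∈ z∈ ιy≡ιz = trans (sym (involutive y∈)) (trans (cong ι ιy≡ιz) (involutive z∈))

    dropFixed : fixed? x ≡ true → IsSignReversing l
    dropFixed fx = restrict there closedTail isr
      where
        closedTail : ∀ {y} → y ∈ l → ι y ∈ l
        closedTail {y} y∈l with closed (there y∈l)
        ... | there ιy∈l = ιy∈l
        ... | here ιy≡x  = contradiction (subst (_∈ l) y≡x y∈l) x∉l
          where
            y≡x : y ≡ x
            y≡x = ι-injective (there y∈l) (here refl) (trans ιy≡x (sym (proj₁ (onFixed (here refl) fx))))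

    module _ (fx : fixed? x ≡ false) where

      partner∈ : ι x ∈ l
      partner∈ with closed (here refl)
      ... | here ιx≡x  = contradiction ιx≡x (proj₁ (onMoved (here refl) fx))
      ... | there ιx∈l = ιx∈l

      partner-moved : fixed? (ι x) ≡ false
      partner-moved with fixed? (ι x) in e
      ... | false = refl
      ... | true  = contradiction (trans (sym (involutive (here refl))) (proj₁ (onFixed (there partner∈) e)))
                                  (proj₁ (onMoved (here refl) fx) ∘ sym)

      dropPair : IsSignReversing (remove (ι x) l)
      dropPair = restrict (there ∘ proj₁ ∘ ∈-remove⁻ l) closed' isr
        where
          closed' : ∀ {z} → z ∈ remove (ι x) l → ι z ∈ remove (ι x) l
          closed' {z} z∈ with ∈-remove⁻ l z∈
          ... | z∈l , z≢ιx with closed (there z∈l)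
          ...   | here ιz≡x  = contradiction (ι-injective (there z∈l) (there partner∈) (trans ιz≡x (sym (involutive (here refl))))) z≢ιx
          ...   | there ιz∈l = ∈-remove⁺ ιz∈l (λ ιz≡ιx → x∉l (subst (_∈ l) (ι-injective (there z∈l) (here refl) ιz≡ιx) z∈l))

  -- Induction on the length: a fixed head is counted once; a moved head x
  -- cancels against its partner ι x, and both are removed.
  Σsign≡#fixed : ∀ l → Unique l → IsSignReversing l → Σsign l ≡ + #fixed l
  Σsign≡#fixed l = bounded (length l) l ≤-refl
    where
    bounded : ∀ k l → length l ≤ k → Unique l → IsSignReversing l → Σsign l ≡ + #fixed l
    bounded _       []      _         _          _   = refl
    bounded (suc k) (x ∷ l) (s≤s len) (x∉ ∷ u) isr with fixed? x in fx
    ... | true  = cong₂ _+ℤ_ (proj₂ (onFixed (here refl) fx)) (bounded k l len u (dropFixed x∉l isr fx))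
      where
        open IsSignReversing isr
        x∉l : x ∉ l
        x∉l = Unique[x∷xs]⇒x∉xs (x∉ ∷ u)
    ... | false =
      begin
        sign x +ℤ Σsign l                        ≡⟨ cong (sign x +ℤ_) (Σsign-remove l u (partner∈ x∉l isr fx)) ⟩
        sign x +ℤ (sign (ι x) +ℤ Σsign l')       ≡⟨ ℤ.+-assoc (sign x) (sign (ι x)) _ ⟨
        (sign x +ℤ sign (ι x)) +ℤ Σsign l'       ≡⟨ cong (λ t → (sign x +ℤ t) +ℤ Σsign l') (proj₂ (onMoved (here refl) fx)) ⟩
        (sign x +ℤ - sign x) +ℤ Σsign l'         ≡⟨ cong (_+ℤ Σsign l') (ℤ.+-inverseʳ (sign x)) ⟩
        0ℤ +ℤ Σsign l'                           ≡⟨ ℤ.+-identityˡ _ ⟩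
        Σsign l'                                 ≡⟨ bounded k l' shorter (unique-remove u) (dropPair x∉l isr fx) ⟩
        + #fixed l'                              ≡⟨ cong +_ (#fixed-remove l (partner-moved x∉l isr fx)) ⟩
        + #fixed l                               ∎
      where
        open ≡-Reasoning
        open IsSignReversing isr
        x∉l : x ∉ l
        x∉l = Unique[x∷xs]⇒x∉xs (x∉ ∷ u)
        l' : List X
        l' = remove (ι x) l
        shorter : length l' ≤ k
        shorter = ≤-trans (<⇒≤ (length-remove (partner∈ x∉l isr fx))) len

module Words {n : ℕ} where

  open import Data.Nat using (_≤_)

  open DecMembership (_≟ᶠ_ {n}) using (_∈?_)

  distinct⇒Unique : ∀ (xs : List (Fin n)) → T (distinctᵇ xs) → Unique xs
  distinct⇒Unique [] _ = []
  distinct⇒Unique (x ∷ xs) t with any (λ y → ⌊ x ≟ᶠ y ⌋) xs in e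
  ... | false = ¬Any⇒All¬ xs (λ x∈xs → subst T e (any⁺ _ (Any.map fromWitness x∈xs))) ∷ distinct⇒Unique xs t

  Unique⇒distinct : ∀ (xs : List (Fin n)) → Unique xs → T (distinctᵇ xs)
  Unique⇒distinct [] _ = tt
  Unique⇒distinct (x ∷ xs) (x∉xs ∷ u) with any (λ y → ⌊ x ≟ᶠ y ⌋) xs in e
  ... | false = Unique⇒distinct xs u
  ... | true  = contradiction (Any.map toWitness (any⁻ _ xs (subst T (sym e) tt))) (All¬⇒¬Any x∉xs)

  words-complete : ∀ k (xs : List (Fin n)) → length xs ≡ k → xs ∈ words n k
  words-complete zero [] refl = here refl
  words-complete (suc k) (x ∷ xs) refl =
    ∈-concat⁺′ (∈-map⁺ (x ∷_) (words-complete k xs refl))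
               (∈-map⁺ (λ v → map (v ∷_) (words n k)) (∈-allFin x))

  words-length : ∀ k {xs : List (Fin n)} → xs ∈ words n k → length xs ≡ k
  words-length zero (here refl) = refl
  words-length (suc k) xs∈ with ∈-concat⁻′ (map (λ v → map (v ∷_) (words n k)) (allFin n)) xs∈
  ... | ys , xs∈ys , ys∈ with ∈-map⁻ (λ v → map (v ∷_) (words n k)) ys∈
  ...   | v , _ , refl with ∈-map⁻ (v ∷_) xs∈ys
  ...     | w , w∈ , refl = cong suc (words-length k w∈)

  words-unique : ∀ k → Unique (words n k)
  words-unique zero = [] ∷ []
  words-unique (suc k) =
    UniqueP.concat⁺ (AllP.map⁺ (All.tabulate (λ _ → UniqueP.map⁺ ∷-injectiveʳ (words-unique k))))
                   (AllPairsP.map⁺ (AllPairs.map disjoint (UniqueP.allFin⁺ n)))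
    where
      disjoint : ∀ {v v'} → v ≢ v' → ∀ {u} → ¬ (u ∈ map (v ∷_) (words n k) × u ∈ map (v' ∷_) (words n k))
      disjoint v≢v' (u∈ , u∈') with ∈-map⁻ _ u∈ | ∈-map⁻ _ u∈'
      ... | _ , _ , refl | _ , _ , eq = v≢v' (∷-injectiveˡ eq)

  -- Pigeonhole: a duplicate-free word of length n uses every letter of [n].
  unique-full : ∀ (xs : List (Fin n)) → Unique xs → length xs ≡ n → ∀ v → v ∈ xs
  unique-full xs u len v with v ∈? xs
  ... | yes v∈xs = v∈xs
  ... | no v∉xs = contradiction (≤-<-trans n≤ (length-remove (∈-allFin v))) (<-irrefl (sym (length-tabulate (λ i → i))))
    where
      open Removal _≟ᶠ_
      xs⊆ : ∀ {x} → x ∈ xs → x ∈ remove v (allFin n)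
      xs⊆ {x} x∈xs = ∈-remove⁺ (∈-allFin x) (λ x≡v → v∉xs (subst (_∈ xs) x≡v x∈xs))
      n≤ : n ≤ length (remove v (allFin n))
      n≤ = subst (_≤ length (remove v (allFin n))) len (unique-⊆-length u xs⊆)

module Indexing where

  open import Data.Nat using (_<_)

  count : ∀ {a} {A : Set a} → (A → Bool) → List A → ℕ
  count g xs = length (filterᵇ g xs)

  applyUpTo-cong : ∀ {A B C : Set} (g : A → C) (g' : B → C) (f : ℕ → A) (f' : ℕ → B) {k k'}
                 → k ≡ k' → (∀ t → t < k → g (f t) ≡ g' (f' t))
                 → map g (applyUpTo f k) ≡ map g' (applyUpTo f' k')
  applyUpTo-cong g g' f f' {zero}  refl h = refl
  applyUpTo-cong g g' f f' {suc k} refl h =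
    cong₂ _∷_ (h 0 (s≤s z≤n)) (applyUpTo-cong g g' (f ∘ suc) (f' ∘ suc) refl (λ t t<k → h (suc t) (s≤s t<k)))

  all-applyUpTo-cong : ∀ {A B : Set} (g : A → Bool) (g' : B → Bool) (f : ℕ → A) (f' : ℕ → B) {k k'}
                     → k ≡ k' → (∀ t → t < k → g (f t) ≡ g' (f' t))
                     → all g (applyUpTo f k) ≡ all g' (applyUpTo f' k')
  all-applyUpTo-cong g g' f f' k≡k' h = cong and (applyUpTo-cong g g' f f' k≡k' h)

  any-applyUpTo-cong : ∀ {A B : Set} (g : A → Bool) (g' : B → Bool) (f : ℕ → A) (f' : ℕ → B) {k k'}
                     → k ≡ k' → (∀ t → t < k → g (f t) ≡ g' (f' t))
                     → any g (applyUpTo f k) ≡ any g' (applyUpTo f' k')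
  any-applyUpTo-cong g g' f f' k≡k' h = cong or (applyUpTo-cong g g' f f' k≡k' h)

  count-results : ∀ {a} {A : Set a} (g : A → Bool) xs → count g xs ≡ count id (map g xs)
  count-results g [] = refl
  count-results g (x ∷ xs) with g x
  ... | true  = cong suc (count-results g xs)
  ... | false = count-results g xs

  count-applyUpTo-cong : ∀ {A B : Set} (g : A → Bool) (g' : B → Bool) (f : ℕ → A) (f' : ℕ → B) {k k'}
                       → k ≡ k' → (∀ t → t < k → g (f t) ≡ g' (f' t))
                       → count g (applyUpTo f k) ≡ count g' (applyUpTo f' k')
  count-applyUpTo-cong g g' f f' {k} {k'} k≡k' h =
    begin
      count g (applyUpTo f k)               ≡⟨ count-results g (applyUpTo f k) ⟩
      count id (map g (applyUpTo f k))      ≡⟨ cong (count id) (applyUpTo-cong g g' f f' k≡k' h) ⟩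
      count id (map g' (applyUpTo f' k'))   ≡⟨ count-results g' (applyUpTo f' k') ⟨
      count g' (applyUpTo f' k')            ∎
    where open ≡-Reasoning

  count-map : ∀ {a b} {A : Set a} {B : Set b} (g : B → Bool) (f : A → B) xs → count g (map f xs) ≡ count (g ∘ f) xs
  count-map g f xs = trans (count-results g (map f xs)) (trans (cong (count id) (sym (map-∘ xs))) (sym (count-results (g ∘ f) xs)))

  count-reject : ∀ {A : Set} (g : A → Bool) z zs → g z ≡ false → count g (z ∷ zs) ≡ count g zs
  count-reject g z zs gz with g z
  ... | false = refl

  count-++ : ∀ {A : Set} (g : A → Bool) xs ys → count g (xs ++ ys) ≡ count g xs + count g ys
  count-++ g xs ys = trans (cong length (filter-++ _ xs ys)) (length-++ (filterᵇ g xs))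

  count-∧ : ∀ {A : Set} (g h : A → Bool) xs → length (filterᵇ g (filterᵇ h xs)) ≡ count (λ x → h x ∧ g x) xs
  count-∧ g h [] = refl
  count-∧ g h (x ∷ xs) with h x
  ... | false = count-∧ g h xs
  ... | true with g x
  ...   | true  = cong suc (count-∧ g h xs)
  ...   | false = count-∧ g h xs

  applyUpTo-+ : ∀ {A : Set} (f : ℕ → A) a b → applyUpTo f (a + b) ≡ applyUpTo f a ++ applyUpTo (λ t → f (a + t)) b
  applyUpTo-+ f zero    b = refl
  applyUpTo-+ f (suc a) b = cong (f 0 ∷_) (applyUpTo-+ (f ∘ suc) a b)

module Positions {n : ℕ} where

  open import Data.Nat using (_≤_; _<_)

  valueOf : Maybe (Fin n) → ℕ
  valueOf (just v) = suc (toℕ v)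
  valueOf nothing  = 0

  val-letter : ∀ (σ : List (Fin n)) i → val σ i ≡ valueOf (letter σ i)
  val-letter σ i with letter σ i
  ... | just v  = refl
  ... | nothing = refl

  letter-++ʳ : ∀ (pre ys : List (Fin n)) u → letter (pre ++ ys) (suc (length pre + u)) ≡ letter ys (suc u)
  letter-++ʳ []        ys u = refl
  letter-++ʳ (x ∷ pre) ys u = letter-++ʳ pre ys u

  letter-++ˡ : ∀ (c post : List (Fin n)) u → u < length c → letter (c ++ post) (suc u) ≡ letter c (suc u)
  letter-++ˡ (x ∷ c) post zero    _         = refl
  letter-++ˡ (x ∷ c) post (suc u) (s≤s u<c) = letter-++ˡ c post u u<c

  letter-window : ∀ (pre c post : List (Fin n)) u → u < length c
                → letter (pre ++ c ++ post) (suc (length pre + u)) ≡ letter c (suc u)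
  letter-window pre c post u u<c = trans (letter-++ʳ pre (c ++ post) u) (letter-++ˡ c post u u<c)

  val-window : ∀ (pre c post : List (Fin n)) i → 1 ≤ i → i ≤ length c
             → val (pre ++ c ++ post) (length pre + i) ≡ val c i
  val-window pre c post (suc u) _ i≤c =
    begin
      val (pre ++ c ++ post) (length pre + suc u)           ≡⟨ val-letter (pre ++ c ++ post) _ ⟩
      valueOf (letter (pre ++ c ++ post) (length pre + suc u)) ≡⟨ cong (valueOf ∘ letter (pre ++ c ++ post)) (+-suc (length pre) u) ⟩
      valueOf (letter (pre ++ c ++ post) (suc (length pre + u))) ≡⟨ cong valueOf (letter-window pre c post u i≤c) ⟩
      valueOf (letter c (suc u))                              ≡⟨ val-letter c (suc u) ⟨
      val c (suc u)                                           ∎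
    where open ≡-Reasoning

  val-∷ : ∀ (x : Fin n) xs i → 1 ≤ i → val (x ∷ xs) (suc i) ≡ val xs i
  val-∷ x xs (suc i) _ = trans (val-letter (x ∷ xs) (suc (suc i))) (sym (val-letter xs (suc i)))

module Profile where

  open import Data.Nat using (_≤_; _<_)

  open Indexing

  ascending : (ℕ → ℕ) → ℕ → Bool
  ascending V k = all (λ u → V (suc u) <ᵇ V (suc (suc u))) (upTo k)

  descentAt : (ℕ → ℕ) → ℕ → Bool
  descentAt V u = V (suc (suc u)) <ᵇ V (suc u)

  descents : (ℕ → ℕ) → ℕ → ℕ
  descents V k = count (descentAt V) (upTo k)

  -- V 1 > ⋯ > V (t+1) < ⋯ < V k
  valleyAt : (ℕ → ℕ) → ℕ → ℕ → Bool
  valleyAt V k t = all (λ u → V (suc (suc u)) <ᵇ V (suc u)) (upTo t)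
                 ∧ all (λ u → V (suc (t + u)) <ᵇ V (suc (suc (t + u)))) (upTo (k ∸ 1 ∸ t))

  unimodal : (ℕ → ℕ) → ℕ → Bool
  unimodal V k = any (valleyAt V k) (upTo k)

  private
    suc-<-∸ : ∀ x k → x < k ∸ 1 → suc x < k
    suc-<-∸ x (suc k) x<k = s≤s x<k

    +-<-∸ : ∀ u m t → u < m ∸ t → t + u < m
    +-<-∸ u m       zero    u<m = u<m
    +-<-∸ u (suc m) (suc t) u<m = s≤s (+-<-∸ u m t u<m)

  ascending-cong : ∀ V V' k → (∀ i → 1 ≤ i → i ≤ suc k → V i ≡ V' i) → ascending V k ≡ ascending V' k
  ascending-cong V V' k V≗V' = all-applyUpTo-cong _ _ id id refl λ u u<k →
    cong₂ _<ᵇ_ (V≗V' (suc u) (s≤s z≤n) (<⇒≤ (s≤s u<k))) (V≗V' (suc (suc u)) (s≤s z≤n) (s≤s u<k))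

  descents-cong : ∀ V V' k → (∀ i → 1 ≤ i → i ≤ suc k → V i ≡ V' i) → descents V k ≡ descents V' k
  descents-cong V V' k V≗V' = count-applyUpTo-cong _ _ id id refl λ u u<k →
    cong₂ _<ᵇ_ (V≗V' (suc (suc u)) (s≤s z≤n) (s≤s u<k)) (V≗V' (suc u) (s≤s z≤n) (<⇒≤ (s≤s u<k)))

  unimodal-cong : ∀ V V' k → (∀ i → 1 ≤ i → i ≤ k → V i ≡ V' i) → unimodal V k ≡ unimodal V' k
  unimodal-cong V V' k V≗V' = any-applyUpTo-cong _ _ id id refl λ t t<k → cong₂ _∧_
    (all-applyUpTo-cong _ _ id id refl λ u u<t → cong₂ _<ᵇ_
       (V≗V' (suc (suc u)) (s≤s z≤n) (≤-trans (s≤s u<t) t<k))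
       (V≗V' (suc u) (s≤s z≤n) (≤-trans (<⇒≤ (s≤s u<t)) t<k)))
    (all-applyUpTo-cong _ _ id id refl λ u u<r →
       let t+u<k = suc-<-∸ (t + u) k (+-<-∸ u (k ∸ 1) t u<r) in cong₂ _<ᵇ_
       (V≗V' (suc (t + u)) (s≤s z≤n) (<⇒≤ t+u<k))
       (V≗V' (suc (suc (t + u))) (s≤s z≤n) t+u<k))

  ascending-suc : ∀ V k → ascending V (suc k) ≡ (V 1 <ᵇ V 2) ∧ ascending (V ∘ suc) k
  ascending-suc V k = cong ((V 1 <ᵇ V 2) ∧_)
    (all-applyUpTo-cong (λ u → V (suc u) <ᵇ V (suc (suc u))) (λ u → V (suc (suc u)) <ᵇ V (suc (suc (suc u))))
                        suc id {k} {k} refl (λ _ _ → refl))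

  descents-suc : ∀ V k → descents V (suc k) ≡ (if V 2 <ᵇ V 1 then 1 else 0) + descents (V ∘ suc) k
  descents-suc V k with V 2 <ᵇ V 1
  ... | true  = cong suc (count-applyUpTo-cong (descentAt V) (descentAt (V ∘ suc)) suc id {k} {k} refl (λ _ _ → refl))
  ... | false = count-applyUpTo-cong (descentAt V) (descentAt (V ∘ suc)) suc id {k} {k} refl (λ _ _ → refl)

  unimodal-suc : ∀ V k → unimodal V (suc k) ≡ ascending V k ∨ ((V 2 <ᵇ V 1) ∧ unimodal (V ∘ suc) k)
  unimodal-suc V k = cong (ascending V k ∨_)
    (trans (any-applyUpTo-cong (valleyAt V (suc k)) (λ t → (V 2 <ᵇ V 1) ∧ valleyAt (V ∘ suc) k t) suc id {k} {k} refl λ t _ →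
              trans (cong₂ _∧_
                       (cong ((V 2 <ᵇ V 1) ∧_)
                          (all-applyUpTo-cong (λ u → V (suc (suc u)) <ᵇ V (suc u))
                                              (λ u → V (suc (suc (suc u))) <ᵇ V (suc (suc u))) suc id {t} {t} refl (λ _ _ → refl)))
                       (all-applyUpTo-cong (λ u → V (suc (suc t + u)) <ᵇ V (suc (suc (suc t + u))))
                                           (λ u → V (suc (suc (t + u))) <ᵇ V (suc (suc (suc (t + u))))) id id
                                           (sym (∸-+-assoc k 1 t)) (λ _ _ → refl)))
                    (∧-assoc (V 2 <ᵇ V 1) _ _))
           (any-∧ (V 2 <ᵇ V 1) (valleyAt (V ∘ suc) k) (upTo k)))
    where
      any-∧ : ∀ {A : Set} b (g : A → Bool) xs → any (λ x → b ∧ g x) xs ≡ b ∧ any g xs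
      any-∧ true  g xs       = refl
      any-∧ false g []       = refl
      any-∧ false g (x ∷ xs) = any-∧ false g xs

  unimodalOn-window : ∀ {n} (σ : List (Fin n)) p k
                    → unimodalOnᵇ σ (suc p , p + suc k) ≡ unimodal (λ i → val σ (p + i)) (suc k)
  unimodalOn-window σ p k = any-applyUpTo-cong _ _ (λ t → suc (p + t)) id (m+n∸m≡n p (suc k)) body
    where
      shift : ∀ t u → p + suc (t + u) ≡ suc (p + t + u)
      shift t u = trans (+-suc p (t + u)) (cong suc (sym (+-assoc p t u)))
      body : ∀ t → t < (p + suc k) ∸ p
           → (all (λ j → val σ (suc j) <ᵇ val σ j) (range (suc p) (suc (p + t) ∸ 1))
              ∧ all (λ j → val σ j <ᵇ val σ (suc j)) (range (suc (p + t)) (p + suc k ∸ 1)))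
             ≡ valleyAt (λ i → val σ (p + i)) (suc k) t
      body t _ = cong₂ _∧_
        (all-applyUpTo-cong _ _ (λ u → suc (p + u)) id (m+n∸m≡n p t)
          (λ u _ → cong₂ _<ᵇ_ (cong (val σ) (sym (trans (+-suc p (suc u)) (cong suc (+-suc p u)))))
                              (cong (val σ) (sym (+-suc p u)))))
        (all-applyUpTo-cong _ _ (λ u → suc ((p + t) + u)) id
          (trans (cong (λ m → m ∸ 1 ∸ (p + t)) (+-suc p k)) ([m+n]∸[m+o]≡n∸o p k t))
          (λ u _ → cong₂ _<ᵇ_ (cong (val σ) (sym (shift t u)))
                              (cong (val σ) (sym (trans (+-suc p (suc (t + u))) (cong suc (shift t u)))))))

module Valleys {n : ℕ} where

  open import Data.Nat using (_≤_; _<_)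

  _≺_ : Fin n → Fin n → Set
  a ≺ b = toℕ a < toℕ b

  Increasing Decreasing : List (Fin n) → Set
  Increasing = AllPairs _≺_
  Decreasing = AllPairs (λ a b → b ≺ a)

  increasingᵇ : List (Fin n) → Bool
  increasingᵇ (x ∷ y ∷ r) = (toℕ x <ᵇ toℕ y) ∧ increasingᵇ (y ∷ r)
  increasingᵇ _           = true

  unimodalᵂ : List (Fin n) → Bool
  unimodalᵂ (x ∷ y ∷ r) = increasingᵇ (x ∷ y ∷ r) ∨ ((toℕ y <ᵇ toℕ x) ∧ unimodalᵂ (y ∷ r))
  unimodalᵂ _           = true

  descentsᵂ : List (Fin n) → ℕ
  descentsᵂ (x ∷ y ∷ r) = (if toℕ y <ᵇ toℕ x then 1 else 0) + descentsᵂ (y ∷ r)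
  descentsᵂ _           = 0

  <ᵇ⇒≺ : ∀ {a b : Fin n} → T (toℕ a <ᵇ toℕ b) → a ≺ b
  <ᵇ⇒≺ {a} {b} = <ᵇ⇒< (toℕ a) (toℕ b)

  increasingᵇ⇒Increasing : ∀ c → T (increasingᵇ c) → Increasing c
  increasingᵇ⇒Increasing []          _ = []
  increasingᵇ⇒Increasing (x ∷ [])    _ = [] ∷ []
  increasingᵇ⇒Increasing (x ∷ y ∷ r) t =
    let x<y , t' = Equivalence.to T-∧ t
    in prepend (<ᵇ⇒≺ x<y) (increasingᵇ⇒Increasing (y ∷ r) t')
    where
      prepend : ∀ {x y r} → x ≺ y → Increasing (y ∷ r) → Increasing (x ∷ y ∷ r)
      prepend x<y inc@(y<r ∷ _) = (x<y ∷ All.map (<-trans x<y) y<r) ∷ inc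

  Increasing⇒increasingᵇ : ∀ c → Increasing c → T (increasingᵇ c)
  Increasing⇒increasingᵇ []          _ = tt
  Increasing⇒increasingᵇ (x ∷ [])    _ = tt
  Increasing⇒increasingᵇ (x ∷ y ∷ r) ((x<y ∷ _) ∷ inc) =
    Equivalence.from T-∧ (<⇒<ᵇ x<y , Increasing⇒increasingᵇ (y ∷ r) inc)

  record Valley (c : List (Fin n)) : Set where
    constructor valley
    field
      left   : List (Fin n)
      bottom : Fin n
      right  : List (Fin n)
      split  : c ≡ left ++ bottom ∷ right
      falls  : Decreasing (left ++ [ bottom ])
      rises  : Increasing (bottom ∷ right)

  unimodal⇒Valley : ∀ x xs → T (unimodalᵂ (x ∷ xs)) → Valley (x ∷ xs)
  unimodal⇒Valley x []      _ = valley [] x [] refl ([] ∷ []) ([] ∷ [])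
  unimodal⇒Valley x (y ∷ r) t with Equivalence.to T-∨ t
  ... | inj₁ inc = valley [] x (y ∷ r) refl ([] ∷ []) (increasingᵇ⇒Increasing _ inc)
  ... | inj₂ t' with Equivalence.to T-∧ t'
  ...   | y<x , t'' with unimodal⇒Valley y r t''
  ...     | valley L m R eq dec inc =
    valley (x ∷ L) m R (cong (x ∷_) eq) (All.tabulate (below L eq dec) ∷ dec) inc
    where
      -- the first letter y of y ∷ r is the largest one of L ++ [ m ], and y is below x
      below : ∀ L' → y ∷ r ≡ L' ++ m ∷ R → Decreasing (L' ++ [ m ]) → ∀ {z} → z ∈ L' ++ [ m ] → z ≺ x
      below []       refl _          (here refl) = <ᵇ⇒≺ y<x
      below (w ∷ L') refl _          (here refl) = <ᵇ⇒≺ y<x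
      below (w ∷ L') refl (w>L' ∷ _) (there z∈)  = <-trans (All.lookup w>L' z∈) (<ᵇ⇒≺ y<x)

  Valley⇒unimodal : ∀ {c} → Valley c → T (unimodalᵂ c)
  Valley⇒unimodal (valley [] m [] refl _ _) = tt
  Valley⇒unimodal (valley [] m (y ∷ R) refl _ inc) =
    Equivalence.from T-∨ (inj₁ (Increasing⇒increasingᵇ (m ∷ y ∷ R) inc))
  Valley⇒unimodal (valley (x ∷ []) m R refl ((m<x ∷ []) ∷ dec) inc) =
    Equivalence.from T-∨ (inj₂ (Equivalence.from T-∧ (<⇒<ᵇ m<x , Valley⇒unimodal (valley [] m R refl dec inc))))
  Valley⇒unimodal (valley (x ∷ y ∷ L) m R refl ((y<x ∷ _) ∷ dec) inc) =
    Equivalence.from T-∨ (inj₂ (Equivalence.from T-∧ (<⇒<ᵇ y<x , Valley⇒unimodal (valley (y ∷ L) m R refl dec inc))))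

  private
    <ᵇ-false : ∀ {a b} → ¬ a < b → (a <ᵇ b) ≡ false
    <ᵇ-false {a} {b} a≮b with a <ᵇ b in e
    ... | false = refl
    ... | true  = contradiction (<ᵇ⇒< a b (subst T (sym e) tt)) a≮b

    descentsᵂ-rises : ∀ m R → Increasing (m ∷ R) → descentsᵂ (m ∷ R) ≡ 0
    descentsᵂ-rises m []      _                  = refl
    descentsᵂ-rises m (y ∷ R) ((m<y ∷ _) ∷ inc) rewrite <ᵇ-false (<⇒≯ m<y) = descentsᵂ-rises y R inc

    descentsᵂ-fall : ∀ (x z : Fin n) r → z ≺ x → descentsᵂ (x ∷ z ∷ r) ≡ suc (descentsᵂ (z ∷ r))
    descentsᵂ-fall x z r z<x rewrite Equivalence.to T-≡ (<⇒<ᵇ z<x) = refl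

  descents-valley : ∀ L m R → Decreasing (L ++ [ m ]) → Increasing (m ∷ R) → descentsᵂ (L ++ m ∷ R) ≡ length L
  descents-valley []          m R _                    inc = descentsᵂ-rises m R inc
  descents-valley (x ∷ [])    m R ((m<x ∷ []) ∷ _)     inc = trans (descentsᵂ-fall x m R m<x) (cong suc (descentsᵂ-rises m R inc))
  descents-valley (x ∷ y ∷ L) m R ((y<x ∷ _) ∷ dec)    inc =
    trans (descentsᵂ-fall x y (L ++ m ∷ R) y<x) (cong suc (descents-valley (y ∷ L) m R dec inc))

  Decreasing-before : ∀ xs y ys → Decreasing (xs ++ y ∷ ys) → All (y ≺_) xs
  Decreasing-before []       y ys _            = []
  Decreasing-before (x ∷ xs) y ys (x≻ ∷ dec) = All.lookup x≻ (∈-++⁺ʳ xs (here refl)) ∷ Decreasing-before xs y ys dec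

  bottom-least : ∀ L m R → Decreasing (L ++ [ m ]) → Increasing (m ∷ R) → ∀ {y} → y ∈ L ++ m ∷ R → toℕ m ≤ toℕ y
  bottom-least L m R dec (m<R ∷ _) y∈ with ∈-++⁻ L y∈
  ... | inj₁ y∈L          = <⇒≤ (All.lookup (Decreasing-before L m [] dec) y∈L)
  ... | inj₂ (here refl)  = ≤-refl
  ... | inj₂ (there y∈R)  = <⇒≤ (All.lookup m<R y∈R)

  least-last : ∀ L (e : Fin n) → Decreasing L → e ∈ L → (∀ {x} → x ∈ L → toℕ e ≤ toℕ x) → ∃ λ L₀ → L ≡ L₀ ++ [ e ]
  least-last (x ∷ [])    e _                  (here refl) _   = [] , refl
  least-last (x ∷ y ∷ L) e ((y<x ∷ _) ∷ _)    (here refl) e≤  = contradiction (e≤ (there (here refl))) (<⇒≱ y<x)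
  least-last (x ∷ y ∷ L) e (_ ∷ dec)          (there e∈)  e≤  =
    let L₀ , eq = least-last (y ∷ L) e dec e∈ (e≤ ∘ there) in x ∷ L₀ , cong (x ∷_) eq

  Decreasing-insert : ∀ L m e → Decreasing (L ++ [ m ]) → All (e ≺_) L → m ≺ e → Decreasing (L ++ e ∷ [ m ])
  Decreasing-insert []      m e _            _           m≺e = (m≺e ∷ []) ∷ [] ∷ []
  Decreasing-insert (x ∷ L) m e (x≻ ∷ dec) (e≺x ∷ e≺L) m≺e =
    AllP.++⁺ (AllP.++⁻ˡ L x≻) (e≺x ∷ AllP.++⁻ʳ L x≻) ∷ Decreasing-insert L m e dec e≺L m≺e

module WordStatistics {n : ℕ} where

  open Indexing
  open Positions {n}
  open Profile
  open Valleys {n}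

  ascending-val : ∀ (x : Fin n) xs → ascending (val (x ∷ xs)) (length xs) ≡ increasingᵇ (x ∷ xs)
  ascending-val x []      = refl
  ascending-val x (y ∷ r) =
    trans (ascending-suc (val (x ∷ y ∷ r)) (length r))
          (cong ((toℕ x <ᵇ toℕ y) ∧_)
                (trans (ascending-cong _ _ (length r) (λ i 1≤i _ → val-∷ x (y ∷ r) i 1≤i)) (ascending-val y r)))

  descents-val : ∀ (x : Fin n) xs → descents (val (x ∷ xs)) (length xs) ≡ descentsᵂ (x ∷ xs)
  descents-val x []      = refl
  descents-val x (y ∷ r) =
    trans (descents-suc (val (x ∷ y ∷ r)) (length r))
          (cong ((if toℕ y <ᵇ toℕ x then 1 else 0) +_)
                (trans (descents-cong _ _ (length r) (λ i 1≤i _ → val-∷ x (y ∷ r) i 1≤i)) (descents-val y r)))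

  unimodal-val : ∀ (x : Fin n) xs → unimodal (val (x ∷ xs)) (suc (length xs)) ≡ unimodalᵂ (x ∷ xs)
  unimodal-val x []      = refl
  unimodal-val x (y ∷ r) =
    trans (unimodal-suc (val (x ∷ y ∷ r)) (suc (length r)))
          (cong₂ _∨_ (ascending-val x (y ∷ r))
                     (cong ((toℕ y <ᵇ toℕ x) ∧_)
                           (trans (unimodal-cong _ _ (suc (length r)) (λ i 1≤i _ → val-∷ x (y ∷ r) i 1≤i)) (unimodal-val y r))))

module Chunks {n : ℕ} where

  open import Data.Nat using (_≤_; _<_)

  open Indexing
  open Positions {n}
  open Profile
  open Valleys {n}
  open WordStatistics {n}

  NonEmpty : List (Fin n) → Set
  NonEmpty c = 0 < length c

  unimodalOn-chunk : ∀ (pre c post : List (Fin n)) → NonEmpty c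
                   → unimodalOnᵇ (pre ++ c ++ post) (suc (length pre) , length pre + length c) ≡ unimodalᵂ c
  unimodalOn-chunk pre (x ∷ c) post _ =
    begin
      unimodalOnᵇ (pre ++ (x ∷ c) ++ post) (suc (length pre) , length pre + suc (length c))
        ≡⟨ unimodalOn-window (pre ++ (x ∷ c) ++ post) (length pre) (length c) ⟩
      unimodal (λ i → val (pre ++ (x ∷ c) ++ post) (length pre + i)) (suc (length c))
        ≡⟨ unimodal-cong _ _ (suc (length c)) (val-window pre (x ∷ c) post) ⟩
      unimodal (val (x ∷ c)) (suc (length c))
        ≡⟨ unimodal-val x c ⟩
      unimodalᵂ (x ∷ c)
        ∎
    where open ≡-Reasoning

  unimodal-chunks : ∀ σ (pre : List (Fin n)) cs → σ ≡ pre ++ concat cs → All NonEmpty cs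
                  → all (unimodalOnᵇ σ) (blocksFrom (length pre) (map length cs)) ≡ all unimodalᵂ cs
  unimodal-chunks σ pre []       _    _          = refl
  unimodal-chunks σ pre (c ∷ cs) refl (c≠[] ∷ ne) =
    cong₂ _∧_ (unimodalOn-chunk pre c (concat cs) c≠[])
              (trans (cong (λ p → all (unimodalOnᵇ σ) (blocksFrom p (map length cs))) (sym (length-++ pre)))
                     (unimodal-chunks σ (pre ++ c) cs (sym (++-assoc pre c (concat cs))) ne))

  letters-chunk : ∀ (pre c post : List (Fin n))
                → mapMaybe (letter (pre ++ c ++ post)) (range (suc (length pre)) (length pre + length c)) ≡ c
  letters-chunk pre c post =
    begin
      mapMaybe (letter σ) (applyUpTo (λ t → suc (length pre + t)) (suc (length pre + length c) ∸ suc (length pre)))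
        ≡⟨ cong (λ k → mapMaybe (letter σ) (applyUpTo (λ t → suc (length pre + t)) k)) (m+n∸m≡n (length pre) (length c)) ⟩
      catMaybes (map (letter σ) (applyUpTo (λ t → suc (length pre + t)) (length c)))
        ≡⟨ cong catMaybes (applyUpTo-cong (letter σ) (letter c) (λ t → suc (length pre + t)) suc refl
                                          (λ t t<c → letter-window pre c post t t<c)) ⟩
      catMaybes (map (letter c) (applyUpTo suc (length c)))
        ≡⟨ all-letters c ⟩
      c ∎
    where
      open ≡-Reasoning
      σ : List (Fin n)
      σ = pre ++ c ++ post
      all-letters : ∀ (c : List (Fin n)) → catMaybes (map (letter c) (applyUpTo suc (length c))) ≡ c
      all-letters [] = refl
      all-letters (x ∷ c) = cong (x ∷_) (trans (cong catMaybes (applyUpTo-cong (letter (x ∷ c)) (letter c) (suc ∘ suc) suc {length c} refl (λ _ _ → refl)))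
                                               (all-letters c))

  descentᵇ : List (Fin n) → ℕ → Bool
  descentᵇ σ i = val σ (suc i) <ᵇ val σ i

  private
    ≡ᵇ-false : ∀ m n → m ≢ n → (m ≡ᵇ n) ≡ false
    ≡ᵇ-false m n m≢n with m ≡ᵇ n in e
    ... | false = refl
    ... | true  = contradiction (≡ᵇ⇒≡ m n (subst T (sym e) _)) m≢n

    ≡ᵇ-refl : ∀ m → (m ≡ᵇ m) ≡ true
    ≡ᵇ-refl m with m ≡ᵇ m in e
    ... | true  = refl
    ... | false = contradiction (subst T e (≡⇒≡ᵇ m m refl)) λ ()

    ∉-partialSums : ∀ p ks i → All (0 <_) ks → i ≤ p → (i ∈ᵇ partialSums p ks) ≡ false
    ∉-partialSums p []            i _          _   = refl
    ∉-partialSums p (k ∷ [])      i _          _   = refl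
    ∉-partialSums p (k ∷ k' ∷ ks) i (0<k ∷ 0<ks) i≤p =
      cong₂ _∨_ (≡ᵇ-false i (p + k) (λ i≡ → <-irrefl i≡ (≤-<-trans i≤p (m<m+n p 0<k))))
                (∉-partialSums (p + k) (k' ∷ ks) i 0<ks (≤-trans i≤p (m≤m+n p k)))

  descent-window : ∀ (pre c post : List (Fin n)) t → suc (suc t) ≤ length c
                 → descentᵇ (pre ++ c ++ post) (suc (length pre + t)) ≡ descentᵇ c (suc t)
  descent-window pre c post t t+2≤c = cong₂ _<ᵇ_
    (trans (cong (val σ ∘ suc) (sym (+-suc (length pre) t))) (val-at (suc t) t+2≤c))
    (val-at t (<⇒≤ t+2≤c))
    where
      σ : List (Fin n)
      σ = pre ++ c ++ post
      val-at : ∀ t → suc t ≤ length c → val σ (suc (length pre + t)) ≡ val c (suc t)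
      val-at t t<c = trans (cong (val σ) (sym (+-suc (length pre) t))) (val-window pre c post (suc t) (s≤s z≤n) t<c)

  descents-chunks : ∀ σ (pre : List (Fin n)) c cs → σ ≡ pre ++ concat (c ∷ cs) → All NonEmpty (c ∷ cs)
    → count (λ i → descentᵇ σ i ∧ not (i ∈ᵇ partialSums (length pre) (map length (c ∷ cs))))
            (applyUpTo (λ t → suc (length pre + t)) (sum (map length (c ∷ cs)) ∸ 1))
      ≡ sum (map descentsᵂ (c ∷ cs))
  descents-chunks σ pre (x ∷ xs) [] refl _ =
    begin
      count (λ i → descentᵇ σ i ∧ not false) (applyUpTo (λ t → suc (length pre + t)) (length xs + 0))
        ≡⟨ count-applyUpTo-cong _ (descentᵇ (x ∷ xs) ∘ suc) (λ t → suc (length pre + t)) id (+-identityʳ (length xs))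
             (λ t t<xs → trans (∧-identityʳ _) (descent-window pre (x ∷ xs) [] t (s≤s (subst (t <_) (+-identityʳ (length xs)) t<xs)))) ⟩
      descents (val (x ∷ xs)) (length xs)
        ≡⟨ descents-val x xs ⟩
      descentsᵂ (x ∷ xs)
        ≡⟨ +-identityʳ _ ⟨
      descentsᵂ (x ∷ xs) + 0 ∎
    where open ≡-Reasoning
  descents-chunks σ pre c ([] ∷ cs) _ (_ ∷ () ∷ _)
  descents-chunks σ pre (x ∷ xs) ((y ∷ ys) ∷ cs) refl (_ ∷ ne) =
    begin
      count keep (applyUpTo pos (length xs + suc K))
        ≡⟨ cong (count keep) (applyUpTo-+ pos (length xs) (suc K)) ⟩
      count keep (applyUpTo pos (length xs) ++ applyUpTo (λ t → pos (length xs + t)) (suc K))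
        ≡⟨ count-++ keep (applyUpTo pos (length xs)) _ ⟩
      count keep (applyUpTo pos (length xs)) + count keep (applyUpTo (λ t → pos (length xs + t)) (suc K))
        ≡⟨ cong₂ _+_ inside (trans (count-reject keep (pos (length xs + 0)) _ boundary) later) ⟩
      descentsᵂ (x ∷ xs) + sum (map descentsᵂ rest) ∎
    where
      open ≡-Reasoning
      c : List (Fin n)
      c = x ∷ xs
      rest : List (List (Fin n))
      rest = (y ∷ ys) ∷ cs
      p p' K : ℕ
      p = length pre
      p' = p + suc (length xs)
      K = length ys + sum (map length cs)
      pos : ℕ → ℕ
      pos t = suc (p + t)
      inS : ℕ → Bool
      inS i = i ∈ᵇ partialSums p' (map length rest)
      keep : ℕ → Bool
      keep i = descentᵇ σ i ∧ not (i ∈ᵇ partialSums p (map length (c ∷ rest)))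

      -- positions strictly inside c are not block ends
      inside : count keep (applyUpTo pos (length xs)) ≡ descentsᵂ c
      inside = trans (count-applyUpTo-cong keep (descentᵇ c ∘ suc) pos id refl keep-inside) (descents-val x xs)
        where
          keep-inside : ∀ t → t < length xs → keep (pos t) ≡ descentᵇ c (suc t)
          keep-inside t t<xs = begin
            descentᵇ σ (pos t) ∧ not ((pos t ≡ᵇ p') ∨ inS (pos t))  ≡⟨ cong (λ b → descentᵇ σ (pos t) ∧ not b) (cong₂ _∨_ not-end not-later) ⟩
            descentᵇ σ (pos t) ∧ true                              ≡⟨ ∧-identityʳ _ ⟩
            descentᵇ σ (pos t)                                     ≡⟨ descent-window pre c (concat rest) t (s≤s t<xs) ⟩
            descentᵇ c (suc t)                                     ∎
            where
              not-end : (pos t ≡ᵇ p') ≡ false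
              not-end = ≡ᵇ-false (pos t) p' (λ e → <-irrefl (+-cancelˡ-≡ p t (length xs) (suc-injective (trans e (+-suc p (length xs))))) t<xs)
              not-later : inS (pos t) ≡ false
              not-later = ∉-partialSums p' (map length rest) (pos t) (AllP.map⁺ ne)
                            (subst (suc (p + t) ≤_) (sym (+-suc p (length xs))) (s≤s (+-monoʳ-≤ p (<⇒≤ t<xs))))

      -- the last position of c ends a block
      boundary : keep (pos (length xs + 0)) ≡ false
      boundary = trans (cong (λ b → descentᵇ σ (pos (length xs + 0)) ∧ not (b ∨ inS (pos (length xs + 0))))
                             (trans (cong (_≡ᵇ p') end) (≡ᵇ-refl p')))
                       (∧-zeroʳ _)
        where
          end : pos (length xs + 0) ≡ p'
          end = trans (cong (λ j → suc (p + j)) (+-identityʳ (length xs))) (sym (+-suc p (length xs)))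

      -- the remaining positions are those of the later chunks, from offset p'
      later : count keep (applyUpTo (λ t → pos (length xs + suc t)) K) ≡ sum (map descentsᵂ rest)
      later = begin
        count keep (applyUpTo (λ t → pos (length xs + suc t)) K)
          ≡⟨ count-applyUpTo-cong keep keep' (λ t → pos (length xs + suc t)) (λ t → suc (p' + t)) {K} {K} refl keep-later ⟩
        count keep' (applyUpTo (λ t → suc (p' + t)) K)
          ≡⟨ subst (λ q → count (λ i → descentᵇ σ i ∧ not (i ∈ᵇ partialSums q (map length rest)))
                                (applyUpTo (λ t → suc (q + t)) K) ≡ sum (map descentsᵂ rest))
                   (length-++ pre)
                   (descents-chunks σ (pre ++ c) (y ∷ ys) cs (sym (++-assoc pre c (concat rest))) ne) ⟩
        sum (map descentsᵂ rest) ∎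
        where
          keep' : ℕ → Bool
          keep' i = descentᵇ σ i ∧ not (inS i)
          keep-later : ∀ t → t < K → keep (pos (length xs + suc t)) ≡ keep' (suc (p' + t))
          keep-later t _ = begin
            keep (pos (length xs + suc t))                                           ≡⟨⟩
            descentᵇ σ (pos (length xs + suc t)) ∧ not ((pos (length xs + suc t) ≡ᵇ p') ∨ inS (pos (length xs + suc t)))
              ≡⟨ cong (λ b → descentᵇ σ (pos (length xs + suc t)) ∧ not (b ∨ inS (pos (length xs + suc t)))) after-end ⟩
            keep' (pos (length xs + suc t))                                          ≡⟨ cong keep' shifted ⟩
            keep' (suc (p' + t))                                                     ∎
            where
              shifted : pos (length xs + suc t) ≡ suc (p' + t)
              shifted = cong suc (trans (cong (p +_) (+-suc (length xs) t)) (sym (+-assoc p (suc (length xs)) t)))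
              after-end : (pos (length xs + suc t) ≡ᵇ p') ≡ false
              after-end = ≡ᵇ-false _ p' (λ e → <-irrefl (trans (sym e) shifted) (s≤s (m≤m+n p' t)))

  unimodal-concat : ∀ (α : Composition n) cs → map length cs ≡ parts α → All NonEmpty cs
                  → unimodalᵇ α (concat cs) ≡ all unimodalᵂ cs
  unimodal-concat α cs lengths ne =
    trans (cong (λ ks → all (unimodalOnᵇ (concat cs)) (blocksFrom 0 ks)) (sym lengths))
          (unimodal-chunks (concat cs) [] cs refl ne)

  desNotInS-concat : ∀ (α : Composition n) cs → map length cs ≡ parts α → All NonEmpty cs
                   → desNotInS α (concat cs) ≡ sum (map descentsᵂ cs)
  desNotInS-concat α cs lengths ne =
    begin
      desNotInS α σ
        ≡⟨ count-∧ (λ i → not (i ∈ᵇ S α)) (descentᵇ σ) (range 1 (n ∸ 1)) ⟩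
      count keep (range 1 (n ∸ 1))
        ≡⟨ cong (λ k → count keep (range 1 (k ∸ 1))) (trans (sym (sums α)) (cong sum (sym lengths))) ⟩
      count keep (range 1 (sum (map length cs) ∸ 1))
        ≡⟨ inside-chunks cs lengths ne ⟩
      sum (map descentsᵂ cs) ∎
    where
      open ≡-Reasoning
      σ : List (Fin n)
      σ = concat cs
      keep : ℕ → Bool
      keep i = descentᵇ σ i ∧ not (i ∈ᵇ S α)
      inside-chunks : ∀ cs → map length cs ≡ parts α → All NonEmpty cs
        → count (λ i → descentᵇ (concat cs) i ∧ not (i ∈ᵇ S α)) (range 1 (sum (map length cs) ∸ 1))
          ≡ sum (map descentsᵂ cs)
      inside-chunks []       _       _  = refl
      inside-chunks (c ∷ cs) lengths ne rewrite sym lengths = descents-chunks (concat (c ∷ cs)) [] c cs refl ne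

module AllPairsSplit {A : Set} {R : A → A → Set} where

  ++⁻ˡ : ∀ xs {ys} → AllPairs R (xs ++ ys) → AllPairs R xs
  ++⁻ˡ []       _          = []
  ++⁻ˡ (x ∷ xs) (rx ∷ rxs) = AllP.++⁻ˡ xs rx ∷ ++⁻ˡ xs rxs

  ++⁻ʳ : ∀ xs {ys} → AllPairs R (xs ++ ys) → AllPairs R ys
  ++⁻ʳ []       rys        = rys
  ++⁻ʳ (x ∷ xs) (_ ∷ rxs)  = ++⁻ʳ xs rxs

  ++⁻across : ∀ xs {ys} → AllPairs R (xs ++ ys) → All (λ x → All (R x) ys) xs
  ++⁻across []       _          = []
  ++⁻across (x ∷ xs) (rx ∷ rxs) = AllP.++⁻ʳ xs rx ∷ ++⁻across xs rxs

  concat⁻ : ∀ (cs : List (List A)) → AllPairs R (concat cs) → All (AllPairs R) cs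
  concat⁻ []       _ = []
  concat⁻ (c ∷ cs) r = ++⁻ˡ c r ∷ concat⁻ cs (++⁻ʳ c r)

  dropMiddle : ∀ xs (y : A) ys → AllPairs R (xs ++ y ∷ ys) → AllPairs R (xs ++ ys)
  dropMiddle []       y ys (_ ∷ rys) = rys
  dropMiddle (x ∷ xs) y ys (rx ∷ rxs) =
    AllP.++⁺ (AllP.++⁻ˡ xs rx) (All.tail (AllP.++⁻ʳ xs rx)) ∷ dropMiddle xs y ys rxs

  replaceMiddle : ∀ pre {mid mid'} post → mid' ↭ mid → AllPairs R mid'
                → AllPairs R (pre ++ mid ++ post) → AllPairs R (pre ++ mid' ++ post)
  replaceMiddle pre {mid} post p rmid' r =
    AllPairsP.++⁺ (++⁻ˡ pre r)
      (AllPairsP.++⁺ rmid' (++⁻ʳ mid (++⁻ʳ pre r)) (↭.All-resp-↭ (↭-sym p) (++⁻across mid (++⁻ʳ pre r))))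
      (All.map (λ rx → AllP.++⁺ (↭.All-resp-↭ (↭-sym p) (AllP.++⁻ˡ mid rx)) (AllP.++⁻ʳ mid rx)) (++⁻across pre r))

module WordOperations {n : ℕ} where

  open import Data.Nat using (_≤_)

  open Valleys {n}
  open Removal (_≟ᶠ_ {n}) public using (remove; remove-∉; remove-↭; remove-last; remove-other)

  least : Fin n → List (Fin n) → Fin n
  least x []       = x
  least x (y ∷ ys) = least (if toℕ y <ᵇ toℕ x then y else x) ys

  leastOf : List (Fin n) → Maybe (Fin n)
  leastOf []       = nothing
  leastOf (x ∷ xs) = just (least x xs)

  private
    least-∈ : ∀ x xs → least x xs ∈ x ∷ xs
    least-∈ x []       = here refl
    least-∈ x (y ∷ ys) with toℕ y <ᵇ toℕ x
    ... | true  = there (least-∈ y ys)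
    ... | false with least-∈ x ys
    ...   | here eq = here eq
    ...   | there m = there (there m)

    least-≤ : ∀ x xs {z} → z ∈ x ∷ xs → toℕ (least x xs) ≤ toℕ z
    least-≤ x []       (here refl) = ≤-refl
    least-≤ x (y ∷ ys) z∈ with toℕ y <ᵇ toℕ x in e
    least-≤ x (y ∷ ys) (here refl)         | true = ≤-trans (least-≤ y ys (here refl)) (<⇒≤ (<ᵇ⇒≺ (Equivalence.from T-≡ e)))
    least-≤ x (y ∷ ys) (there (here refl)) | true = least-≤ y ys (here refl)
    least-≤ x (y ∷ ys) (there (there z∈))  | true = least-≤ y ys (there z∈)
    least-≤ x (y ∷ ys) (here refl)         | false = least-≤ x ys (here refl)
    least-≤ x (y ∷ ys) (there (here refl)) | false = ≤-trans (least-≤ x ys (here refl)) (≮⇒≥ (λ y<x → subst T e (<⇒<ᵇ y<x)))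
    least-≤ x (y ∷ ys) (there (there z∈))  | false = least-≤ x ys (there z∈)

  leastOf-sound : ∀ xs {x} → leastOf xs ≡ just x → x ∈ xs × (∀ {y} → y ∈ xs → toℕ x ≤ toℕ y)
  leastOf-sound (z ∷ zs) refl = least-∈ z zs , least-≤ z zs

  leastOf-complete : ∀ xs {x} → x ∈ xs → (∀ {y} → y ∈ xs → toℕ x ≤ toℕ y) → leastOf xs ≡ just x
  leastOf-complete (z ∷ zs) x∈ x≤ =
    cong just (toℕ-injective (≤-antisym (least-≤ z zs x∈) (x≤ (least-∈ z zs))))

  leastOf-nothing : ∀ xs → leastOf xs ≡ nothing → xs ≡ []
  leastOf-nothing [] _ = refl

  cutAt : Fin n → List (Fin n) → List (Fin n) × List (Fin n)
  cutAt m []       = [] , []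
  cutAt m (x ∷ xs) with x ≟ᶠ m
  ... | yes _ = [] , xs
  ... | no  _ = x ∷ proj₁ (cutAt m xs) , proj₂ (cutAt m xs)

  cutAt-++ : ∀ m L R → m ∉ L → cutAt m (L ++ m ∷ R) ≡ (L , R)
  cutAt-++ m []      R _ with m ≟ᶠ m
  ... | yes _  = refl
  ... | no m≢m = contradiction refl m≢m
  cutAt-++ m (x ∷ L) R m∉ with x ≟ᶠ m
  ... | yes refl = contradiction (here refl) m∉
  ... | no _ rewrite cutAt-++ m L R (m∉ ∘ there) = refl

  insert : Fin n → List (Fin n) → List (Fin n)
  insert e []       = e ∷ []
  insert e (x ∷ xs) = if toℕ e <ᵇ toℕ x then e ∷ x ∷ xs else x ∷ insert e xs

  insert-↭ : ∀ e R → insert e R ↭ e ∷ R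
  insert-↭ e []      = ↭-refl
  insert-↭ e (x ∷ R) with toℕ e <ᵇ toℕ x
  ... | true  = ↭-refl
  ... | false = ↭-trans (prep x (insert-↭ e R)) (swap x e ↭-refl)

  insert-Increasing : ∀ e R → Increasing R → e ∉ R → Increasing (insert e R)
  insert-Increasing e []      _              _  = [] ∷ []
  insert-Increasing e (x ∷ R) (x<R ∷ inc) e∉ with toℕ e <ᵇ toℕ x in e<x
  ... | true  = let e≺x = <ᵇ⇒≺ (Equivalence.from T-≡ e<x) in (e≺x ∷ All.map (<-trans e≺x) x<R) ∷ x<R ∷ inc
  ... | false = ↭.All-resp-↭ (↭-sym (insert-↭ e R)) (x≺e ∷ x<R) ∷ insert-Increasing e R inc (e∉ ∘ there)
    where
      x≺e : x ≺ e
      x≺e with <-cmp (toℕ x) (toℕ e)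
      ... | tri< x<e _ _ = x<e
      ... | tri≈ _ x≡e _ = contradiction (here (sym (toℕ-injective x≡e))) e∉
      ... | tri> _ _ e≺x = contradiction (<⇒<ᵇ e≺x) (subst T e<x)

  remove-Increasing : ∀ e R → Increasing R → Increasing (remove e R)
  remove-Increasing e R = AllPairsP.filter⁺ _

  insert-remove : ∀ e R → Increasing R → e ∈ R → insert e (remove e R) ≡ R
  insert-remove e (x ∷ R) (x<R ∷ inc) (here refl) with x ≟ᶠ x
  ... | yes _  rewrite remove-∉ R (λ x∈R → <-irrefl refl (All.lookup x<R x∈R)) = insert-front x R x<R
    where
      insert-front : ∀ e R → All (e ≺_) R → insert e R ≡ e ∷ R
      insert-front e []      _         = refl
      insert-front e (x ∷ R) (e≺x ∷ _) rewrite Equivalence.to T-≡ (<⇒<ᵇ e≺x) = refl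
  ... | no x≢x = contradiction refl x≢x
  insert-remove e (x ∷ R) (x<R ∷ inc) (there e∈) with x ≟ᶠ e
  ... | yes refl = contradiction (All.lookup x<R e∈) (<-irrefl refl)
  ... | no _ with toℕ e <ᵇ toℕ x in e<x
  ...   | true  = contradiction (All.lookup x<R e∈) (<-asym (<ᵇ⇒≺ (Equivalence.from T-≡ e<x)))
  ...   | false = cong (x ∷_) (insert-remove e R inc e∈)

  remove-insert : ∀ e R → e ∉ R → remove e (insert e R) ≡ R
  remove-insert e []      _ with e ≟ᶠ e
  ... | yes _  = refl
  ... | no e≢e = contradiction refl e≢e
  remove-insert e (x ∷ R) e∉ with toℕ e <ᵇ toℕ x
  ... | true with e ≟ᶠ e
  ...   | yes _  = remove-∉ (x ∷ R) e∉
  ...   | no e≢e = contradiction refl e≢e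
  remove-insert e (x ∷ R) e∉ | false with x ≟ᶠ e
  ...   | yes refl = contradiction (here refl) e∉
  ...   | no _     = cong (x ∷_) (remove-insert e R (e∉ ∘ there))

module MinimalElements {n : ℕ} {c ℓ₁ ℓ₂ : Level} (Lp : LabeledPoset n c ℓ₁ ℓ₂) (natural : NaturallyLabeled Lp) where

  open import Data.Nat using (_≤_; _<_)

  module P = LabeledPoset Lp
  open P using (from; _<Pᵇ_; w)
  open Valleys {n}
  open Removal (_≟ᶠ_ {n}) public using (Unique-↭)
  open Removal (_≟ᶠ_ {n}) using (unique-⊆-length)

  _⊏_ : Fin n → Fin n → Bool
  x ⊏ y = from x <Pᵇ from y

  ⊏⇒≺ : ∀ {x y} → T (x ⊏ y) → x ≺ y
  ⊏⇒≺ {x} {y} t with P._≤?_ (from x) (from y) | P._≟_ (from x) (from y)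
  ... | yes x≤y | no x≉y = subst₂ (λ a b → toℕ a < toℕ b) (Inverse.strictlyInverseˡ w x) (Inverse.strictlyInverseˡ w y)
                                  (natural (from x) (from y) (x≤y , x≉y))

  ⊏-irrefl : ∀ {x} → ¬ T (x ⊏ x)
  ⊏-irrefl {x} t with P._≤?_ (from x) (from x) | P._≟_ (from x) (from x)
  ... | yes _ | no x≉x = x≉x P.Eq.refl

  Minimal : List (Fin n) → Fin n → Set
  Minimal cc x = ∀ {y} → y ∈ cc → ¬ T (y ⊏ x)

  minimalᵇ : List (Fin n) → Fin n → Bool
  minimalᵇ cc x = not (any (_⊏ x) cc)

  minimals : List (Fin n) → List (Fin n)
  minimals cc = filterᵇ (minimalᵇ cc) cc

  uniqueMinimalᵇ : List (Fin n) → Bool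
  uniqueMinimalᵇ cc = length (minimals cc) ≡ᵇ 1

  Compatible : List (Fin n) → Set
  Compatible = AllPairs (λ a b → ¬ T (b ⊏ a))

  private
    T-not⁻ : ∀ {b} → T (not b) → ¬ T b
    T-not⁻ {false} _ ()

    T-not⁺ : ∀ {b} → ¬ T b → T (not b)
    T-not⁺ {true}  ¬t = ¬t tt
    T-not⁺ {false} _  = tt

  ∈-minimals⁻ : ∀ {cc x} → x ∈ minimals cc → x ∈ cc × Minimal cc x
  ∈-minimals⁻ {cc} {x} x∈ with ∈-filter⁻ (T? ∘ minimalᵇ cc) {xs = cc} x∈
  ... | x∈cc , t = x∈cc , λ y∈ y⊏x → T-not⁻ t (any⁺ (_⊏ x) (lose y∈ y⊏x))

  ∈-minimals⁺ : ∀ {cc x} → x ∈ cc → Minimal cc x → x ∈ minimals cc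
  ∈-minimals⁺ {cc} {x} x∈cc min =
    ∈-filter⁺ (T? ∘ minimalᵇ cc) x∈cc (T-not⁺ (All¬⇒¬Any (All.tabulate min) ∘ any⁻ (_⊏ x) cc))

  Minimal-↭ : ∀ {cc cc' x} → cc ↭ cc' → Minimal cc x → Minimal cc' x
  Minimal-↭ p min y∈ = min (↭.∈-resp-↭ (↭-sym p) y∈)

  minimals-↭ : ∀ {cc cc'} → cc ↭ cc' → ∀ {x} → x ∈ minimals cc → x ∈ minimals cc'
  minimals-↭ p x∈ = let x∈cc , min = ∈-minimals⁻ x∈ in ∈-minimals⁺ (↭.∈-resp-↭ p x∈cc) (Minimal-↭ p min)

  uniqueMinimal-↭ : ∀ {cc cc'} → cc ↭ cc' → Unique cc → uniqueMinimalᵇ cc ≡ uniqueMinimalᵇ cc'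
  uniqueMinimal-↭ p u = cong (_≡ᵇ 1) (≤-antisym
    (unique-⊆-length (UniqueP.filter⁺ _ u) (minimals-↭ p))
    (unique-⊆-length (UniqueP.filter⁺ _ (Unique-↭ p u)) (minimals-↭ (↭-sym p))))

  -- In a compatible valley word L ++ m ∷ R every letter of L is minimal:
  -- letters before it have larger labels, letters after it are not below it.
  left-minimal : ∀ L m R → Compatible (L ++ m ∷ R) → Decreasing (L ++ [ m ]) → All (Minimal (L ++ m ∷ R)) L
  left-minimal []      m R _           _              = []
  left-minimal (x ∷ L) m R (x⋢ ∷ comp) (x≻ ∷ dec) =
    head ∷ All.map extend (All.zip (left-minimal L m R comp dec , AllP.++⁻ˡ L x≻))
    where
      head : Minimal (x ∷ L ++ m ∷ R) x
      head (here refl) = ⊏-irrefl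
      head (there y∈)  = All.lookup x⋢ y∈
      extend : ∀ {y} → Minimal (L ++ m ∷ R) y × y ≺ x → Minimal (x ∷ L ++ m ∷ R) y
      extend (min , y≺x) (here refl) x⊏y = <-asym y≺x (⊏⇒≺ x⊏y)
      extend (min , y≺x) (there z∈)  = min z∈

  -- Conversely, a valley word whose left part consists of minimal elements
  -- is compatible: inside the increasing part this is natural labeling.
  minimal⇒compatible : ∀ L m R → All (Minimal (L ++ m ∷ R)) L → Decreasing (L ++ [ m ]) → Increasing (m ∷ R)
                     → Compatible (L ++ m ∷ R)
  minimal⇒compatible []      m R _            _          inc = AllPairs.map (λ a≺b b⊏a → <-asym a≺b (⊏⇒≺ b⊏a)) inc
  minimal⇒compatible (x ∷ L) m R (min ∷ mins) (_ ∷ dec) inc =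
    All.tabulate (λ y∈ → min (there y∈)) ∷ minimal⇒compatible L m R (All.map (λ min' {y} y∈ → min' (there y∈)) mins) dec inc

  -- The bottom of a valley is minimal: it carries the least label.
  bottom-minimal : ∀ L m R → Decreasing (L ++ [ m ]) → Increasing (m ∷ R) → Minimal (L ++ m ∷ R) m
  bottom-minimal L m R dec inc y∈ y⊏m = <⇒≱ (⊏⇒≺ y⊏m) (bottom-least L m R dec inc y∈)

  private
    length≡1 : ∀ {xs : List (Fin n)} {a b} → length xs ≡ 1 → a ∈ xs → b ∈ xs → a ≡ b
    length≡1 {_ ∷ []} _ (here refl) (here refl) = refl

  -- With a unique minimal element, the left part of a compatible valley is
  -- empty, so the word has no descents.
  uniqueMinimal⇒no-descents : ∀ L m R → Decreasing (L ++ [ m ]) → Increasing (m ∷ R) → Compatible (L ++ m ∷ R)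
                            → uniqueMinimalᵇ (L ++ m ∷ R) ≡ true → descentsᵂ (L ++ m ∷ R) ≡ 0
  uniqueMinimal⇒no-descents []      m R dec inc _    _      = descents-valley [] m R dec inc
  uniqueMinimal⇒no-descents (x ∷ L) m R dec inc comp unique =
    contradiction (cong toℕ (length≡1 one x∈ m∈)) (<⇒≢ (All.lookup (Decreasing-before (x ∷ L) m [] dec) (here refl)) ∘ sym)
    where
      one : length (minimals (x ∷ L ++ m ∷ R)) ≡ 1
      one = ≡ᵇ⇒≡ _ 1 (subst T (sym unique) tt)
      x∈ : x ∈ minimals (x ∷ L ++ m ∷ R)
      x∈ = ∈-minimals⁺ (here refl) (All.lookup (left-minimal (x ∷ L) m R comp dec) (here refl))
      m∈ : m ∈ minimals (x ∷ L ++ m ∷ R)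
      m∈ = ∈-minimals⁺ (∈-++⁺ʳ (x ∷ L) (here refl)) (bottom-minimal (x ∷ L) m R dec inc)

-- The toggle on one block: if the subposet carried by a compatible valley
-- word L ++ m ∷ R has a minimal element other than m, let e be the one of
-- least label; e is either the last letter of L, and moves into the
-- increasing part, or a letter of R, and moves to the end of L.
module BlockToggle {n : ℕ} {c ℓ₁ ℓ₂ : Level} (Lp : LabeledPoset n c ℓ₁ ℓ₂) (natural : NaturallyLabeled Lp) where

  open import Data.Nat using (_≤_)

  open MinimalElements Lp natural
  open Valleys {n}
  open WordOperations {n}
  open DecMembership (_≟ᶠ_ {n}) using (_∈?_)

  rivals : Fin n → List (Fin n) → List (Fin n)
  rivals m cc = remove m (minimals cc)

  moveAcross : Fin n → Fin n → List (Fin n) → List (Fin n)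
  moveAcross m e cc = if does (e ∈? L) then remove e L ++ m ∷ insert e R else L ++ e ∷ m ∷ remove e R
    where
      L R : List (Fin n)
      L = proj₁ (cutAt m cc)
      R = proj₂ (cutAt m cc)

  -- m is the least letter of cc, e the least rival of m (if there is none,
  -- cc is left unchanged)
  toggle : List (Fin n) → List (Fin n)
  toggle cc = maybe (λ m → maybe (λ e → moveAcross m e cc) cc (leastOf (rivals m cc))) cc (leastOf cc)

  record Toggled (cc : List (Fin n)) : Set where
    field
      permutes   : toggle cc ↭ cc
      isValley   : Valley (toggle cc)
      compatible : Compatible (toggle cc)
      oneDescent : suc (descentsᵂ (toggle cc)) ≡ descentsᵂ cc ⊎ descentsᵂ (toggle cc) ≡ suc (descentsᵂ cc)
      involutive : toggle (toggle cc) ≡ cc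

  module _ (L : List (Fin n)) (m : Fin n) (R : List (Fin n))
           (dec : Decreasing (L ++ [ m ])) (inc : Increasing (m ∷ R)) (u : Unique (L ++ m ∷ R))
           (comp : Compatible (L ++ m ∷ R)) (nonUnique : uniqueMinimalᵇ (L ++ m ∷ R) ≡ false) where

    private
      cc : List (Fin n)
      cc = L ++ m ∷ R

      m∈ : m ∈ cc
      m∈ = ∈-++⁺ʳ L (here refl)

      m≤ : ∀ {y} → y ∈ cc → toℕ m ≤ toℕ y
      m≤ = bottom-least L m R dec inc

      m≺L : All (m ≺_) L
      m≺L = Decreasing-before L m [] dec

      m∉L : m ∉ L
      m∉L m∈L = <-irrefl refl (All.lookup m≺L m∈L)

      uR : Unique R
      uR = AllPairs.tail (AllPairsSplit.++⁻ʳ L u)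

      ∈-rivals⁺ : ∀ {cc' x} → x ∈ minimals cc' → x ≢ m → x ∈ rivals m cc'
      ∈-rivals⁺ = Removal.∈-remove⁺ _≟ᶠ_

      rivals-↭ : ∀ {c₁ c₂} → c₁ ↭ c₂ → ∀ {x} → x ∈ rivals m c₁ → x ∈ rivals m c₂
      rivals-↭ {c₁} {c₂} p x∈ = let x∈mins , x≢m = Removal.∈-remove⁻ _≟ᶠ_ (minimals c₁) x∈ in ∈-rivals⁺ {c₂} (minimals-↭ p x∈mins) x≢m

      -- since m is not the only minimal element, it has a rival
      rival : ∃ λ e → leastOf (rivals m cc) ≡ just e
      rival with leastOf (rivals m cc) in eq
      ... | just e  = e , refl
      ... | nothing = contradiction (trans (cong (_≡ᵇ 1) (sym (one-minimal (leastOf-nothing _ eq)))) nonUnique) λ ()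
        where
          m∈mins : m ∈ minimals cc
          m∈mins = ∈-minimals⁺ m∈ (bottom-minimal L m R dec inc)
          only-m : rivals m cc ≡ [] → ∀ {x} → x ∈ minimals cc → x ∈ [ m ]
          only-m none {x} x∈ with x ≟ᶠ m
          ... | yes refl = here refl
          ... | no x≢m   = contradiction (subst (x ∈_) none (∈-rivals⁺ {cc} x∈ x≢m)) λ ()
          one-minimal : rivals m cc ≡ [] → length (minimals cc) ≡ 1
          one-minimal none = ≤-antisym (Removal.unique-⊆-length _≟ᶠ_ (UniqueP.filter⁺ _ u) (only-m none))
                                    (length-nonempty m∈mins)
            where
              length-nonempty : ∀ {x} {xs : List (Fin n)} → x ∈ xs → 1 ≤ length xs
              length-nonempty (here _)  = s≤s z≤n
              length-nonempty (there _) = s≤s z≤n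

      e : Fin n
      e = proj₁ rival

      e∈rivals : e ∈ rivals m cc
      e∈rivals = proj₁ (leastOf-sound (rivals m cc) (proj₂ rival))

      e≤rivals : ∀ {x} → x ∈ rivals m cc → toℕ e ≤ toℕ x
      e≤rivals = proj₂ (leastOf-sound (rivals m cc) (proj₂ rival))

      e∈minimals : e ∈ minimals cc
      e∈minimals = proj₁ (Removal.∈-remove⁻ _≟ᶠ_ (minimals cc) e∈rivals)

      e≢m : e ≢ m
      e≢m = proj₂ (Removal.∈-remove⁻ _≟ᶠ_ (minimals cc) e∈rivals)

      e∈ : e ∈ cc
      e∈ = proj₁ (∈-minimals⁻ e∈minimals)

      m≺e : m ≺ e
      m≺e = ≤∧≢⇒< (m≤ e∈) (λ eq → e≢m (sym (toℕ-injective eq)))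

      left-minimals : All (Minimal cc) L
      left-minimals = left-minimal L m R comp dec

      -- the letters of L are rivals of m, so e has the least label among them
      e≤L : ∀ {x} → x ∈ L → toℕ e ≤ toℕ x
      e≤L x∈L = e≤rivals (∈-rivals⁺ {cc} (∈-minimals⁺ (∈-++⁺ˡ x∈L) (All.lookup left-minimals x∈L))
                                        (λ x≡m → m∉L (subst (_∈ L) x≡m x∈L)))

      toggle-↭ : ∀ c' → c' ↭ cc → toggle c' ≡ moveAcross m e c'
      toggle-↭ c' p
        rewrite leastOf-complete c' (↭.∈-resp-↭ (↭-sym p) m∈) (m≤ ∘ ↭.∈-resp-↭ p)
              | leastOf-complete (rivals m c') (rivals-↭ (↭-sym p) e∈rivals) (e≤rivals ∘ rivals-↭ p) = refl

      moveAcross-cut : ∀ {c' L' R'} → cutAt m c' ≡ (L' , R')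
                     → moveAcross m e c' ≡ (if does (e ∈? L') then remove e L' ++ m ∷ insert e R' else L' ++ e ∷ m ∷ remove e R')
      moveAcross-cut {c'} eq rewrite eq = refl

      toggled : ∀ c' → toggle cc ≡ c' → c' ↭ cc → Valley c' → Compatible c'
              → (suc (descentsᵂ c') ≡ descentsᵂ cc ⊎ descentsᵂ c' ≡ suc (descentsᵂ cc)) → toggle c' ≡ cc → Toggled cc
      toggled _ refl p v comp' d inv = record
        { permutes = p ; isValley = v ; compatible = comp' ; oneDescent = d ; involutive = inv }

      cut-cc : cutAt m cc ≡ (L , R)
      cut-cc = cutAt-++ m L R m∉L

      move-right : e ∈ L → Toggled cc
      move-right e∈L = toggled c' toggle≡ perm (valley L₀ m (insert e R) refl dec₀ inc₀) comp' (inj₁ fewer) involution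
        where
          L₀ : List (Fin n)
          L₀ = proj₁ (least-last L e (AllPairsSplit.++⁻ˡ L dec) e∈L e≤L)
          L≡ : L ≡ L₀ ++ [ e ]
          L≡ = proj₂ (least-last L e (AllPairsSplit.++⁻ˡ L dec) e∈L e≤L)
          cc≡ : cc ≡ L₀ ++ e ∷ m ∷ R
          cc≡ = trans (cong (_++ m ∷ R) L≡) (++-assoc L₀ [ e ] (m ∷ R))
          dec' : Decreasing (L₀ ++ e ∷ [ m ])
          dec' = subst Decreasing (trans (cong (_++ [ m ]) L≡) (++-assoc L₀ [ e ] [ m ])) dec
          e∉L₀ : e ∉ L₀
          e∉L₀ e∈L₀ = <-irrefl refl (All.lookup (Decreasing-before L₀ e [ m ] dec') e∈L₀)
          e∉R : e ∉ R
          e∉R e∈R = All.lookup (All.lookup (AllPairsSplit.++⁻across L u) e∈L) (there e∈R) refl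
          m∉L₀ : m ∉ L₀
          m∉L₀ m∈L₀ = m∉L (subst (m ∈_) (sym L≡) (∈-++⁺ˡ m∈L₀))
          c' : List (Fin n)
          c' = L₀ ++ m ∷ insert e R
          toggle≡ : toggle cc ≡ c'
          toggle≡ = begin
            toggle cc                                                   ≡⟨ toggle-↭ cc ↭-refl ⟩
            moveAcross m e cc                                           ≡⟨ moveAcross-cut {cc} cut-cc ⟩
            (if does (e ∈? L) then remove e L ++ m ∷ insert e R
                              else L ++ e ∷ m ∷ remove e R)             ≡⟨ cong (if_then remove e L ++ m ∷ insert e R else L ++ e ∷ m ∷ remove e R)
                                                                             (dec-true (e ∈? L) e∈L) ⟩
            remove e L ++ m ∷ insert e R                                ≡⟨ cong (λ X → remove e X ++ m ∷ insert e R) L≡ ⟩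
            remove e (L₀ ++ [ e ]) ++ m ∷ insert e R                    ≡⟨ cong (_++ m ∷ insert e R) (remove-last e L₀ e∉L₀) ⟩
            c'                                                          ∎
            where open ≡-Reasoning
          perm : c' ↭ cc
          perm = subst (c' ↭_) (sym cc≡) (↭.++⁺ˡ L₀ (↭-trans (prep m (insert-↭ e R)) (swap m e ↭-refl)))
          dec₀ : Decreasing (L₀ ++ [ m ])
          dec₀ = AllPairsSplit.dropMiddle L₀ e [ m ] dec'
          inc₀ : Increasing (m ∷ insert e R)
          inc₀ = ↭.All-resp-↭ (↭-sym (insert-↭ e R)) (m≺e ∷ AllPairs.head inc) ∷ insert-Increasing e R (AllPairs.tail inc) e∉R
          comp' : Compatible c'
          comp' = minimal⇒compatible L₀ m (insert e R)
                    (All.map (Minimal-↭ (↭-sym perm)) (AllP.++⁻ˡ L₀ (subst (All (Minimal cc)) L≡ left-minimals))) dec₀ inc₀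
          fewer : suc (descentsᵂ c') ≡ descentsᵂ cc
          fewer = begin
            suc (descentsᵂ c')         ≡⟨ cong suc (descents-valley L₀ m (insert e R) dec₀ inc₀) ⟩
            suc (length L₀)            ≡⟨ +-comm 1 (length L₀) ⟩
            length L₀ + 1              ≡⟨ length-++ L₀ ⟨
            length (L₀ ++ [ e ])       ≡⟨ cong length L≡ ⟨
            length L                   ≡⟨ descents-valley L m R dec inc ⟨
            descentsᵂ cc               ∎
            where open ≡-Reasoning
          involution : toggle c' ≡ cc
          involution = begin
            toggle c'                                                         ≡⟨ toggle-↭ c' perm ⟩
            moveAcross m e c'                                                 ≡⟨ moveAcross-cut {c'} (cutAt-++ m L₀ (insert e R) m∉L₀) ⟩
            (if does (e ∈? L₀) then remove e L₀ ++ m ∷ insert e (insert e R)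
                               else L₀ ++ e ∷ m ∷ remove e (insert e R))        ≡⟨ cong (if_then remove e L₀ ++ m ∷ insert e (insert e R)
                                                                                        else L₀ ++ e ∷ m ∷ remove e (insert e R))
                                                                                     (dec-false (e ∈? L₀) e∉L₀) ⟩
            L₀ ++ e ∷ m ∷ remove e (insert e R)                               ≡⟨ cong (λ X → L₀ ++ e ∷ m ∷ X) (remove-insert e R e∉R) ⟩
            L₀ ++ e ∷ m ∷ R                                                   ≡⟨ cc≡ ⟨
            cc                                                                ∎
            where open ≡-Reasoning

      move-left : e ∉ L → Toggled cc
      move-left e∉L = toggled c' toggle≡ perm (valley L' m (remove e R) refl dec' inc') comp' (inj₂ more) involution
        where
          e∈R : e ∈ R
          e∈R with ∈-++⁻ L e∈
          ... | inj₁ e∈L          = contradiction e∈L e∉L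
          ... | inj₂ (here e≡m)   = contradiction e≡m e≢m
          ... | inj₂ (there e∈R)  = e∈R
          L' : List (Fin n)
          L' = L ++ [ e ]
          c' : List (Fin n)
          c' = L' ++ m ∷ remove e R
          toggle≡ : toggle cc ≡ c'
          toggle≡ = begin
            toggle cc                                        ≡⟨ toggle-↭ cc ↭-refl ⟩
            moveAcross m e cc                                ≡⟨ moveAcross-cut {cc} cut-cc ⟩
            (if does (e ∈? L) then remove e L ++ m ∷ insert e R
                              else L ++ e ∷ m ∷ remove e R)  ≡⟨ cong (if_then remove e L ++ m ∷ insert e R else L ++ e ∷ m ∷ remove e R)
                                                                  (dec-false (e ∈? L) e∉L) ⟩
            L ++ e ∷ m ∷ remove e R                          ≡⟨ ++-assoc L [ e ] (m ∷ remove e R) ⟨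
            c'                                               ∎
            where open ≡-Reasoning
          perm : c' ↭ cc
          perm = subst (_↭ cc) (sym (++-assoc L [ e ] (m ∷ remove e R)))
                   (↭.++⁺ˡ L (↭-trans (swap e m ↭-refl) (prep m (↭-sym (remove-↭ e R e∈R uR)))))
          e≺L : All (e ≺_) L
          e≺L = All.tabulate (λ x∈L → ≤∧≢⇒< (e≤L x∈L) (λ eq → e∉L (subst (_∈ L) (sym (toℕ-injective eq)) x∈L)))
          dec' : Decreasing (L' ++ [ m ])
          dec' = subst Decreasing (sym (++-assoc L [ e ] [ m ])) (Decreasing-insert L m e dec e≺L m≺e)
          inc' : Increasing (m ∷ remove e R)
          inc' = subst Increasing (remove-other e m R (e≢m ∘ sym)) (remove-Increasing e (m ∷ R) inc)
          comp' : Compatible c'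
          comp' = minimal⇒compatible L' m (remove e R)
                    (AllP.++⁺ (All.map (Minimal-↭ (↭-sym perm)) left-minimals)
                              (Minimal-↭ (↭-sym perm) (proj₂ (∈-minimals⁻ e∈minimals)) ∷ [])) dec' inc'
          more : descentsᵂ c' ≡ suc (descentsᵂ cc)
          more = begin
            descentsᵂ c'              ≡⟨ descents-valley L' m (remove e R) dec' inc' ⟩
            length (L ++ [ e ])       ≡⟨ length-++ L ⟩
            length L + 1              ≡⟨ +-comm (length L) 1 ⟩
            suc (length L)            ≡⟨ cong suc (descents-valley L m R dec inc) ⟨
            suc (descentsᵂ cc)        ∎
            where open ≡-Reasoning
          m∉L' : m ∉ L'
          m∉L' m∈L' with ∈-++⁻ L m∈L'
          ... | inj₁ m∈L        = m∉L m∈L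
          ... | inj₂ (here m≡e) = e≢m (sym m≡e)
          involution : toggle c' ≡ cc
          involution = begin
            toggle c'                                                           ≡⟨ toggle-↭ c' perm ⟩
            moveAcross m e c'                                                   ≡⟨ moveAcross-cut {c'} (cutAt-++ m L' (remove e R) m∉L') ⟩
            (if does (e ∈? L') then remove e L' ++ m ∷ insert e (remove e R)
                               else L' ++ e ∷ m ∷ remove e (remove e R))        ≡⟨ cong (if_then remove e L' ++ m ∷ insert e (remove e R)
                                                                                        else L' ++ e ∷ m ∷ remove e (remove e R))
                                                                                     (dec-true (e ∈? L') (∈-++⁺ʳ L (here refl))) ⟩
            remove e L' ++ m ∷ insert e (remove e R)                            ≡⟨ cong₂ (λ X Y → X ++ m ∷ Y) (remove-last e L e∉L)
                                                                                           (insert-remove e R (AllPairs.tail inc) e∈R) ⟩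
            cc                                                                  ∎
            where open ≡-Reasoning

    nonUnique-toggled : Toggled (L ++ m ∷ R)
    nonUnique-toggled with e ∈? L
    ... | yes e∈L = move-right e∈L
    ... | no  e∉L = move-left e∉L

module Cutting {A : Set} where

  cut : List ℕ → List A → List (List A)
  cut []       xs = []
  cut (k ∷ ks) xs = take k xs ∷ cut ks (drop k xs)

  private
    take-++ : ∀ (c r : List A) → take (length c) (c ++ r) ≡ c
    take-++ []      r = refl
    take-++ (x ∷ c) r = cong (x ∷_) (take-++ c r)

    drop-++ : ∀ (c r : List A) → drop (length c) (c ++ r) ≡ r
    drop-++ []      r = refl
    drop-++ (x ∷ c) r = drop-++ c r

    length-take : ∀ k (xs : List A) K → length xs ≡ k + K → length (take k xs) ≡ k
    length-take zero    xs       K _  = refl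
    length-take (suc k) (x ∷ xs) K eq = cong suc (length-take k xs K (suc-injective eq))

    length-drop : ∀ k (xs : List A) K → length xs ≡ k + K → length (drop k xs) ≡ K
    length-drop zero    xs       K eq = eq
    length-drop (suc k) (x ∷ xs) K eq = length-drop k xs K (suc-injective eq)

  length-concat : ∀ (cs : List (List A)) → length (concat cs) ≡ sum (map length cs)
  length-concat []       = refl
  length-concat (c ∷ cs) = trans (length-++ c) (cong (length c +_) (length-concat cs))

  cut-concat : ∀ ks (cs : List (List A)) → map length cs ≡ ks → cut ks (concat cs) ≡ cs
  cut-concat []       []       _    = refl
  cut-concat (k ∷ ks) (c ∷ cs) refl =
    cong₂ _∷_ (take-++ c (concat cs)) (trans (cong (cut ks) (drop-++ c (concat cs))) (cut-concat ks cs refl))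

  concat-cut : ∀ ks (xs : List A) → length xs ≡ sum ks → concat (cut ks xs) ≡ xs
  concat-cut []       []  _  = refl
  concat-cut (k ∷ ks) xs eq =
    trans (cong (take k xs ++_) (concat-cut ks (drop k xs) (length-drop k xs (sum ks) eq))) (take++drop≡id k xs)

  lengths-cut : ∀ ks (xs : List A) → length xs ≡ sum ks → map length (cut ks xs) ≡ ks
  lengths-cut []       xs _  = refl
  lengths-cut (k ∷ ks) xs eq = cong₂ _∷_ (length-take k xs (sum ks) eq) (lengths-cut ks (drop k xs) (length-drop k xs (sum ks) eq))

module LinearExtensions {n : ℕ} {c ℓ₁ ℓ₂ : Level} (Lp : LabeledPoset n c ℓ₁ ℓ₂) (natural : NaturallyLabeled Lp) where

  open import Data.Nat using (_≤_; _<_)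

  open MinimalElements Lp natural

  Linear : List (Fin n) → Set
  Linear σ = ∀ {i j} → i ∈ σ → j ∈ σ → T (i ⊏ j) → posOf σ i < posOf σ j

  private
    posOf-head : ∀ (x : Fin n) xs → posOf (x ∷ xs) x ≡ 1
    posOf-head x xs with x ≟ᶠ x
    ... | yes _  = refl
    ... | no x≢x = contradiction refl x≢x

    posOf-tail : ∀ (x : Fin n) xs {v} → x ≢ v → posOf (x ∷ xs) v ≡ suc (posOf xs v)
    posOf-tail x xs {v} x≢v with x ≟ᶠ v
    ... | yes x≡v = contradiction x≡v x≢v
    ... | no _    = refl

    posOf-positive : ∀ (xs : List (Fin n)) {v} → v ∈ xs → 1 ≤ posOf xs v
    posOf-positive (x ∷ xs) {v} _ with x ≟ᶠ v
    ... | yes _ = s≤s z≤n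
    ... | no _  = s≤s z≤n

  Compatible⇒Linear : ∀ σ → Unique σ → Compatible σ → Linear σ
  Compatible⇒Linear (x ∷ xs) _          _            (here refl) (here refl) x⊏x = contradiction x⊏x ⊏-irrefl
  Compatible⇒Linear (x ∷ xs) (x∉ ∷ u) (x⋢ ∷ comp) (here refl) (there j∈) _
    rewrite posOf-head x xs | posOf-tail x xs (All.lookup x∉ j∈) = s≤s (posOf-positive xs j∈)
  Compatible⇒Linear (x ∷ xs) _          (x⋢ ∷ comp) (there i∈) (here refl) i⊏x = contradiction i⊏x (All.lookup x⋢ i∈)
  Compatible⇒Linear (x ∷ xs) (x∉ ∷ u) (x⋢ ∷ comp) (there i∈) (there j∈) i⊏j
    rewrite posOf-tail x xs (All.lookup x∉ i∈) | posOf-tail x xs (All.lookup x∉ j∈) = s≤s (Compatible⇒Linear xs u comp i∈ j∈ i⊏j)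

  Linear⇒Compatible : ∀ σ → Unique σ → Linear σ → Compatible σ
  Linear⇒Compatible []       _          _   = []
  Linear⇒Compatible (x ∷ xs) (x∉ ∷ u) lin = All.tabulate not-below ∷ Linear⇒Compatible xs u linear-tail
    where
      not-below : ∀ {y} → y ∈ xs → ¬ T (y ⊏ x)
      not-below {y} y∈ y⊏x with lin (there y∈) (here refl) y⊏x
      ... | y-before-x rewrite posOf-head x xs | posOf-tail x xs (All.lookup x∉ y∈) with y-before-x
      ...   | s≤s ()
      linear-tail : Linear xs
      linear-tail i∈ j∈ i⊏j with lin (there i∈) (there j∈) i⊏j
      ... | i-before-j rewrite posOf-tail x xs (All.lookup x∉ i∈) | posOf-tail x xs (All.lookup x∉ j∈) = ≤-pred i-before-j

  linExt⇒Linear : ∀ σ → T (linExtᵇ Lp σ) → Linear σ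
  linExt⇒Linear σ t {i} {j} _ _ i⊏j with All.lookup (AllP.all⁺ _ (allFin n) t) (∈-allFin i)
  ... | tᵢ with All.lookup (AllP.all⁺ _ (allFin n) tᵢ) (∈-allFin j)
  ... | tᵢⱼ with i ⊏ j
  ... | true = <ᵇ⇒< _ _ tᵢⱼ

  Linear⇒linExt : ∀ σ → (∀ v → v ∈ σ) → Linear σ → T (linExtᵇ Lp σ)
  Linear⇒linExt σ full lin =
    AllP.all⁻ (λ i → all (λ j → not (i ⊏ j) ∨ (posOf σ i <ᵇ posOf σ j)) (allFin n)) {xs = allFin n}
      (All.tabulate λ {i} _ → AllP.all⁻ (λ j → not (i ⊏ j) ∨ (posOf σ i <ᵇ posOf σ j)) {xs = allFin n}
        (All.tabulate λ {j} _ → pair i j))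
    where
      pair : ∀ i j → T (not (i ⊏ j) ∨ (posOf σ i <ᵇ posOf σ j))
      pair i j with i ⊏ j in i⊏j
      ... | false = tt
      ... | true  = <⇒<ᵇ (lin (full i) (full j) (subst T (sym i⊏j) tt))

module Involution {n : ℕ} {c ℓ₁ ℓ₂ : Level} (Lp : LabeledPoset n c ℓ₁ ℓ₂) (natural : NaturallyLabeled Lp)
                  (α : Composition n) where

  open import Data.Nat using (_<_)

  open Indexing using (count-map; count-results)
  open MinimalElements Lp natural
  open LinearExtensions Lp natural
  open BlockToggle Lp natural
  open Valleys {n}
  open Words {n}
  open Chunks {n}
  open Cutting
  open LabeledPoset Lp using (from; _<Pᵇ_)

  ∈𝓛α⁻ : ∀ {σ} → σ ∈ 𝓛α Lp α → length σ ≡ n × Unique σ × Compatible σ × T (unimodalᵇ α σ)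
  ∈𝓛α⁻ {σ} σ∈ with ∈-filter⁻ (T? ∘ unimodalᵇ α) {xs = 𝓛 Lp} σ∈
  ... | σ∈𝓛 , uni with ∈-filter⁻ (T? ∘ linExtᵇ Lp) {xs = Sym n} σ∈𝓛
  ... | σ∈Sym , lin with ∈-filter⁻ (T? ∘ distinctᵇ) {xs = words n n} σ∈Sym
  ... | σ∈words , dist =
    let u = distinct⇒Unique σ dist in
    words-length n σ∈words , u , Linear⇒Compatible σ u (linExt⇒Linear σ lin) , uni

  ∈𝓛α⁺ : ∀ {σ} → length σ ≡ n → Unique σ → Compatible σ → T (unimodalᵇ α σ) → σ ∈ 𝓛α Lp α
  ∈𝓛α⁺ {σ} len u comp uni =
    ∈-filter⁺ (T? ∘ unimodalᵇ α)
      (∈-filter⁺ (T? ∘ linExtᵇ Lp)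
        (∈-filter⁺ (T? ∘ distinctᵇ) (words-complete n σ len) (Unique⇒distinct σ u))
        (Linear⇒linExt σ (unique-full σ u len) (Compatible⇒Linear σ u comp)))
      uni

  𝓛α-unique : Unique (𝓛α Lp α)
  𝓛α-unique = UniqueP.filter⁺ _ (UniqueP.filter⁺ _ (UniqueP.filter⁺ _ (words-unique n)))

  uniqueMin-chunk : ∀ cc → uniqueMinᵇ Lp (map from cc) ≡ uniqueMinimalᵇ cc
  uniqueMin-chunk cc = cong (_≡ᵇ 1) (begin
    count minimalᴾ (map from cc)           ≡⟨ count-map minimalᴾ from cc ⟩
    count (minimalᴾ ∘ from) cc             ≡⟨ count-results (minimalᴾ ∘ from) cc ⟩
    count id (map (minimalᴾ ∘ from) cc)    ≡⟨ cong (count id) (map-cong (λ x → cong not (cong or (sym (map-∘ cc)))) cc) ⟩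
    count id (map (minimalᵇ cc) cc)        ≡⟨ count-results (minimalᵇ cc) cc ⟨
    count (minimalᵇ cc) cc                 ∎)
    where
      open ≡-Reasoning
      open Indexing using (count)
      minimalᴾ : LabeledPoset.Carrier Lp → Bool
      minimalᴾ p = not (any (_<Pᵇ p) (map from cc))

  uniqueMin-chunks : ∀ σ (pre : List (Fin n)) cs → σ ≡ pre ++ concat cs
                   → all (λ B → uniqueMinᵇ Lp (Pblock Lp σ B)) (blocksFrom (length pre) (map length cs)) ≡ all uniqueMinimalᵇ cs
  uniqueMin-chunks σ pre []       _    = refl
  uniqueMin-chunks σ pre (c ∷ cs) refl =
    cong₂ _∧_ (trans (cong (uniqueMinᵇ Lp ∘ map from) (letters-chunk pre c (concat cs))) (uniqueMin-chunk c))
              (trans (cong (λ p → all (λ B → uniqueMinᵇ Lp (Pblock Lp σ B)) (blocksFrom p (map length cs))) (sym (length-++ pre)))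
                     (uniqueMin-chunks σ (pre ++ c) cs (sym (++-assoc pre c (concat cs)))))

  toggleFirst : List (List (Fin n)) → List (List (Fin n))
  toggleFirst []       = []
  toggleFirst (c ∷ cs) = if uniqueMinimalᵇ c then c ∷ toggleFirst cs else toggle c ∷ cs

  ι : List (Fin n) → List (Fin n)
  ι σ = concat (toggleFirst (cut (parts α) σ))

  sign : List (Fin n) → ℤ
  sign σ = -1ℤ ^ desNotInS α σ

  starred : List (Fin n) → Bool
  starred σ = all (λ B → uniqueMinᵇ Lp (Pblock Lp σ B)) (blocks α)

  Good : List (Fin n) → Set
  Good c = uniqueMinimalᵇ c ≡ true

  toggleFirst-good : ∀ cs → All Good cs → toggleFirst cs ≡ cs
  toggleFirst-good []       _            = refl
  toggleFirst-good (c ∷ cs) (good ∷ gs) rewrite good = cong (c ∷_) (toggleFirst-good cs gs)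

  toggleFirst-bad : ∀ cs₁ c cs₂ → All Good cs₁ → uniqueMinimalᵇ c ≡ false
                  → toggleFirst (cs₁ ++ c ∷ cs₂) ≡ cs₁ ++ toggle c ∷ cs₂
  toggleFirst-bad []        c cs₂ _            bad rewrite bad = refl
  toggleFirst-bad (d ∷ cs₁) c cs₂ (good ∷ gs) bad rewrite good = cong (d ∷_) (toggleFirst-bad cs₁ c cs₂ gs bad)

  data FirstBad (cs : List (List (Fin n))) : Set where
    allGood  : All Good cs → FirstBad cs
    firstBad : ∀ cs₁ c cs₂ → cs ≡ cs₁ ++ c ∷ cs₂ → All Good cs₁ → uniqueMinimalᵇ c ≡ false → FirstBad cs

  firstBad? : ∀ cs → FirstBad cs
  firstBad? []       = allGood []
  firstBad? (c ∷ cs) with uniqueMinimalᵇ c in good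
  ... | false = firstBad [] c cs refl [] good
  ... | true with firstBad? cs
  ...   | allGood gs                    = allGood (good ∷ gs)
  ...   | firstBad cs₁ d cs₂ refl gs bad = firstBad (c ∷ cs₁) d cs₂ refl (good ∷ gs) bad

  private
    nonEmpty : ∀ cs → map length cs ≡ parts α → All NonEmpty cs
    nonEmpty cs lengths = AllP.map⁻ (subst (All (0 <_)) (sym lengths) (positive α))

    toValley : ∀ c → NonEmpty c → T (unimodalᵂ c) → Valley c
    toValley (x ∷ xs) _ = unimodal⇒Valley x xs

  record BlockView (σ : List (Fin n)) : Set where
    field
      concat-blocks : concat (cut (parts α) σ) ≡ σ
      lengths       : map length (cut (parts α) σ) ≡ parts α
      unique        : Unique σ
      compatible    : Compatible σ
      unimodal      : All (T ∘ unimodalᵂ) (cut (parts α) σ)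

  blockView : ∀ {σ} → σ ∈ 𝓛α Lp α → BlockView σ
  blockView {σ} σ∈ = view (∈𝓛α⁻ σ∈)
    where
      cs : List (List (Fin n))
      cs = cut (parts α) σ
      view : length σ ≡ n × Unique σ × Compatible σ × T (unimodalᵇ α σ) → BlockView σ
      view (len , u , comp , uni) = record
        { concat-blocks = concat≡ ; lengths = lengths ; unique = u ; compatible = comp
        ; unimodal = AllP.all⁺ unimodalᵂ cs
                       (subst T (trans (cong (unimodalᵇ α) (sym concat≡)) (unimodal-concat α cs lengths (nonEmpty cs lengths))) uni) }
        where
          len≡ : length σ ≡ sum (parts α)
          len≡ = trans len (sym (sums α))
          concat≡ : concat cs ≡ σ
          concat≡ = concat-cut (parts α) σ len≡
          lengths : map length cs ≡ parts α
          lengths = lengths-cut (parts α) σ len≡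

  concat-∈𝓛α : ∀ cs → map length cs ≡ parts α → Unique (concat cs) → Compatible (concat cs)
             → All (T ∘ unimodalᵂ) cs → concat cs ∈ 𝓛α Lp α
  concat-∈𝓛α cs lengths u comp uni =
    ∈𝓛α⁺ length≡n u comp (subst T (sym (unimodal-concat α cs lengths (nonEmpty cs lengths))) (AllP.all⁻ unimodalᵂ uni))
    where
      length≡n : length (concat cs) ≡ n
      length≡n = trans (length-concat cs) (trans (cong sum lengths) (sums α))

  starred-concat : ∀ cs → map length cs ≡ parts α → starred (concat cs) ≡ all uniqueMinimalᵇ cs
  starred-concat cs lengths =
    trans (cong (λ ks → all (λ B → uniqueMinᵇ Lp (Pblock Lp (concat cs) B)) (blocksFrom 0 ks)) (sym lengths))
          (uniqueMin-chunks (concat cs) [] cs refl)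

  sign-concat : ∀ cs → map length cs ≡ parts α → All NonEmpty cs → sign (concat cs) ≡ -1ℤ ^ sum (map descentsᵂ cs)
  sign-concat cs lengths ne = cong (-1ℤ ^_) (desNotInS-concat α cs lengths ne)

  private
    blocks-compatible : ∀ {σ} → BlockView σ → All Compatible (cut (parts α) σ)
    blocks-compatible {σ} v = AllPairsSplit.concat⁻ _ (subst Compatible (sym concat-blocks) compatible)
      where open BlockView v

    blocks-unique : ∀ {σ} → BlockView σ → All Unique (cut (parts α) σ)
    blocks-unique {σ} v = AllPairsSplit.concat⁻ _ (subst Unique (sym concat-blocks) unique)
      where open BlockView v

  all-good : ∀ {σ} → BlockView σ → All Good (cut (parts α) σ) → ι σ ≡ σ × starred σ ≡ true × sign σ ≡ 1ℤ
  all-good {σ} v goods =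
      trans (cong concat (toggleFirst-good cs goods)) concat-blocks
    , trans (cong starred (sym concat-blocks)) (trans (starred-concat cs lengths) (all-true goods))
    , trans (cong sign (sym concat-blocks)) (trans (sign-concat cs lengths ne) (cong (-1ℤ ^_) (no-descents cs ne (blocks-compatible v) unimodal goods)))
    where
      open BlockView v
      cs : List (List (Fin n))
      cs = cut (parts α) σ
      ne : All NonEmpty cs
      ne = nonEmpty cs lengths
      all-true : ∀ {cs} → All Good cs → all uniqueMinimalᵇ cs ≡ true
      all-true []            = refl
      all-true (good ∷ goods) rewrite good = all-true goods
      no-descents : ∀ cs → All NonEmpty cs → All Compatible cs → All (T ∘ unimodalᵂ) cs → All Good cs
                  → sum (map descentsᵂ cs) ≡ 0
      no-descents []       _           _             _            _             = refl
      no-descents (c ∷ cs) (c≠[] ∷ ne) (comp ∷ comps) (uni ∷ unis) (good ∷ goods)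
        with toValley c c≠[] uni
      ... | valley L m R refl dec inc
        rewrite uniqueMinimal⇒no-descents L m R dec inc comp good = no-descents cs ne comps unis goods

  private
    -1^-suc : ∀ k → -1ℤ ^ suc k ≡ - (-1ℤ ^ k)
    -1^-suc k = ℤ.-1*i≡-i (-1ℤ ^ k)

    sign-flip : ∀ a b d d' → suc d' ≡ d ⊎ d' ≡ suc d → -1ℤ ^ (a + (d' + b)) ≡ - (-1ℤ ^ (a + (d + b)))
    sign-flip a b d d' (inj₁ refl) = begin
      -1ℤ ^ (a + (d' + b))               ≡⟨ ℤ.neg-involutive _ ⟨
      - - (-1ℤ ^ (a + (d' + b)))         ≡⟨ cong -_ (-1^-suc (a + (d' + b))) ⟨
      - (-1ℤ ^ suc (a + (d' + b)))       ≡⟨ cong (λ k → - (-1ℤ ^ k)) (+-suc a (d' + b)) ⟨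
      - (-1ℤ ^ (a + (suc d' + b)))       ∎
      where open ≡-Reasoning
    sign-flip a b d d' (inj₂ refl) = trans (cong (-1ℤ ^_) (+-suc a (d + b))) (-1^-suc (a + (d + b)))

    sum-middle : ∀ (f : List (Fin n) → ℕ) cs₁ c cs₂ → sum (map f (cs₁ ++ c ∷ cs₂)) ≡ sum (map f cs₁) + (f c + sum (map f cs₂))
    sum-middle f cs₁ c cs₂ = trans (cong sum (map-++ f cs₁ (c ∷ cs₂))) (sum-++ (map f cs₁) _)

    concat-middle : ∀ (cs₁ : List (List (Fin n))) c cs₂ → concat (cs₁ ++ c ∷ cs₂) ≡ concat cs₁ ++ c ++ concat cs₂
    concat-middle cs₁ c cs₂ = sym (concat-++ cs₁ (c ∷ cs₂))

    split-All : ∀ {P : List (Fin n) → Set} cs₁ c cs₂ → All P (cs₁ ++ c ∷ cs₂) → All P cs₁ × P c × All P cs₂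
    split-All cs₁ c cs₂ ps = AllP.++⁻ˡ cs₁ ps , All.head (AllP.++⁻ʳ cs₁ ps) , All.tail (AllP.++⁻ʳ cs₁ ps)

    toggled-block : ∀ c → NonEmpty c → Unique c → Compatible c → T (unimodalᵂ c) → uniqueMinimalᵇ c ≡ false → Toggled c
    toggled-block c c≠[] u comp uni bad with toValley c c≠[] uni
    ... | valley L m R refl dec inc = nonUnique-toggled L m R dec inc u comp bad

  module FirstBadBlock {σ} (v : BlockView σ) (cs₁ : List (List (Fin n))) (c : List (Fin n)) (cs₂ : List (List (Fin n)))
                  (cs≡ : cut (parts α) σ ≡ cs₁ ++ c ∷ cs₂) (goods : All Good cs₁) (bad : uniqueMinimalᵇ c ≡ false) where
    open BlockView v

    private
      cs : List (List (Fin n))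
      cs = cut (parts α) σ

      around : ∀ {P : List (Fin n) → Set} → All P cs → All P cs₁ × P c × All P cs₂
      around ps = split-All cs₁ c cs₂ (subst (All _) cs≡ ps)

      unis : All (T ∘ unimodalᵂ) cs₁ × T (unimodalᵂ c) × All (T ∘ unimodalᵂ) cs₂
      unis = around unimodal

      c-unique : Unique c
      c-unique = proj₁ (proj₂ (around (blocks-unique v)))

      toggled : Toggled c
      toggled = toggled-block c (proj₁ (proj₂ (around (nonEmpty cs lengths)))) c-unique
                                (proj₁ (proj₂ (around (blocks-compatible v)))) (proj₁ (proj₂ unis)) bad

      open Toggled toggled renaming (compatible to compatible')

      c' : List (Fin n)
      c' = toggle c

      cs' : List (List (Fin n))
      cs' = cs₁ ++ c' ∷ cs₂

      σ' : List (Fin n)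
      σ' = concat cs'

      σ≡ : σ ≡ concat cs₁ ++ c ++ concat cs₂
      σ≡ = trans (sym concat-blocks) (trans (cong concat cs≡) (concat-middle cs₁ c cs₂))

      σ'↭σ : σ' ↭ σ
      σ'↭σ = subst₂ _↭_ (sym (concat-middle cs₁ c' cs₂)) (sym σ≡) (↭.++⁺ˡ (concat cs₁) (↭.++⁺ʳ (concat cs₂) permutes))

      lengths' : map length cs' ≡ parts α
      lengths' = trans (map-middle cs₁ (↭.↭-length permutes)) (trans (cong (map length) (sym cs≡)) lengths)
        where
          map-middle : ∀ cs₁ → length c' ≡ length c → map length (cs₁ ++ c' ∷ cs₂) ≡ map length (cs₁ ++ c ∷ cs₂)
          map-middle []        eq = cong (_∷ map length cs₂) eq
          map-middle (d ∷ cs₁) eq = cong (length d ∷_) (map-middle cs₁ eq)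

    ι-σ≡ : ι σ ≡ σ'
    ι-σ≡ = cong concat (trans (cong toggleFirst cs≡) (toggleFirst-bad cs₁ c cs₂ goods bad))

    ισ∈ : ι σ ∈ 𝓛α Lp α
    ισ∈ = subst (_∈ 𝓛α Lp α) (sym ι-σ≡)
            (concat-∈𝓛α cs' lengths' (Unique-↭ (↭-sym σ'↭σ) unique)
              (subst Compatible (sym (concat-middle cs₁ c' cs₂))
                 (AllPairsSplit.replaceMiddle (concat cs₁) (concat cs₂) permutes compatible' (subst Compatible σ≡ compatible)))
              (AllP.++⁺ (proj₁ unis) (Valley⇒unimodal isValley ∷ proj₂ (proj₂ unis))))

    involution : ι (ι σ) ≡ σ
    involution = begin
      ι (ι σ)                                  ≡⟨ cong ι ι-σ≡ ⟩
      concat (toggleFirst (cut (parts α) σ'))  ≡⟨ cong (concat ∘ toggleFirst) (cut-concat (parts α) cs' lengths') ⟩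
      concat (toggleFirst cs')                 ≡⟨ cong concat (toggleFirst-bad cs₁ c' cs₂ goods bad') ⟩
      concat (cs₁ ++ toggle c' ∷ cs₂)          ≡⟨ cong (λ d → concat (cs₁ ++ d ∷ cs₂)) involutive ⟩
      concat (cs₁ ++ c ∷ cs₂)                  ≡⟨ cong concat cs≡ ⟨
      concat cs                                ≡⟨ concat-blocks ⟩
      σ                                        ∎
      where
        open ≡-Reasoning
        bad' : uniqueMinimalᵇ c' ≡ false
        bad' = trans (uniqueMinimal-↭ permutes (Unique-↭ (↭-sym permutes) c-unique)) bad

    not-starred : starred σ ≡ false
    not-starred = trans (cong starred (sym concat-blocks))
                    (trans (starred-concat cs lengths) (trans (cong (all uniqueMinimalᵇ) cs≡) (all-false cs₁)))
      where
        all-false : ∀ cs₁ → all uniqueMinimalᵇ (cs₁ ++ c ∷ cs₂) ≡ false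
        all-false []        rewrite bad = refl
        all-false (d ∷ cs₁) = trans (cong (uniqueMinimalᵇ d ∧_) (all-false cs₁)) (∧-zeroʳ _)

    flips : sign (ι σ) ≡ - sign σ
    flips = begin
      sign (ι σ)                                  ≡⟨ cong sign ι-σ≡ ⟩
      sign σ'                                     ≡⟨ sign-concat cs' lengths' (nonEmpty cs' lengths') ⟩
      -1ℤ ^ sum (map descentsᵂ cs')               ≡⟨ cong (-1ℤ ^_) (sum-middle descentsᵂ cs₁ c' cs₂) ⟩
      -1ℤ ^ (A + (descentsᵂ c' + B))              ≡⟨ sign-flip A B (descentsᵂ c) (descentsᵂ c') oneDescent ⟩
      - (-1ℤ ^ (A + (descentsᵂ c + B)))           ≡⟨ cong (λ k → - (-1ℤ ^ k)) (sum-middle descentsᵂ cs₁ c cs₂) ⟨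
      - (-1ℤ ^ sum (map descentsᵂ (cs₁ ++ c ∷ cs₂))) ≡⟨ cong (λ d → - (-1ℤ ^ sum (map descentsᵂ d))) cs≡ ⟨
      - (-1ℤ ^ sum (map descentsᵂ cs))            ≡⟨ cong -_ (sign-concat cs lengths (nonEmpty cs lengths)) ⟨
      - sign (concat cs)                          ≡⟨ cong (λ τ → - sign τ) concat-blocks ⟩
      - sign σ                                    ∎
      where
        open ≡-Reasoning
        A B : ℕ
        A = sum (map descentsᵂ cs₁)
        B = sum (map descentsᵂ cs₂)

  data Analysis (σ : List (Fin n)) : Set where
    fixedPoint : ι σ ≡ σ → starred σ ≡ true → sign σ ≡ 1ℤ → Analysis σ
    movedPoint : ι σ ∈ 𝓛α Lp α → ι (ι σ) ≡ σ → starred σ ≡ false → sign (ι σ) ≡ - sign σ → Analysis σ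

  analyse : ∀ {σ} → σ ∈ 𝓛α Lp α → Analysis σ
  analyse {σ} σ∈ with firstBad? (cut (parts α) σ)
  ... | allGood goods =
    let ισ≡σ , good , sign≡1 = all-good (blockView σ∈) goods in fixedPoint ισ≡σ good sign≡1
  ... | firstBad cs₁ c cs₂ cs≡ goods bad = movedPoint ισ∈ involution not-starred flips
    where open FirstBadBlock (blockView σ∈) cs₁ c cs₂ cs≡ goods bad

  private
    sign≢-sign : ∀ σ → sign σ ≢ - sign σ
    sign≢-sign σ = -1^≢-self (desNotInS α σ)
      where
        -1^≢-self : ∀ k → -1ℤ ^ k ≢ - (-1ℤ ^ k)
        -1^≢-self zero    ()
        -1^≢-self (suc k) eq =
          -1^≢-self k (ℤ.neg-injective (trans (sym (-1^-suc k)) (trans eq (cong -_ (-1^-suc k)))))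

  open SignReversingInvolution (≡-dec _≟ᶠ_) sign starred ι using (IsSignReversing)

  isSignReversing : IsSignReversing (𝓛α Lp α)
  isSignReversing = record { closed = closed ; involutive = involutive ; onFixed = onFixed ; onMoved = onMoved }
    where
      closed : ∀ {σ} → σ ∈ 𝓛α Lp α → ι σ ∈ 𝓛α Lp α
      closed σ∈ with analyse σ∈
      ... | fixedPoint ισ≡σ _ _    = subst (_∈ 𝓛α Lp α) (sym ισ≡σ) σ∈
      ... | movedPoint ισ∈ _ _ _   = ισ∈
      involutive : ∀ {σ} → σ ∈ 𝓛α Lp α → ι (ι σ) ≡ σ
      involutive σ∈ with analyse σ∈
      ... | fixedPoint ισ≡σ _ _    = trans (cong ι ισ≡σ) ισ≡σ
      ... | movedPoint _ ιισ≡σ _ _ = ιισ≡σ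
      onFixed : ∀ {σ} → σ ∈ 𝓛α Lp α → starred σ ≡ true → ι σ ≡ σ × sign σ ≡ 1ℤ
      onFixed σ∈ st with analyse σ∈
      ... | fixedPoint ισ≡σ _ sign≡1 = ισ≡σ , sign≡1
      ... | movedPoint _ _ ¬st _     = contradiction (trans (sym st) ¬st) λ ()
      onMoved : ∀ {σ} → σ ∈ 𝓛α Lp α → starred σ ≡ false → ι σ ≢ σ × sign (ι σ) ≡ - sign σ
      onMoved {σ} σ∈ ¬st with analyse σ∈
      ... | fixedPoint _ st _          = contradiction (trans (sym st) ¬st) λ ()
      ... | movedPoint _ _ _ flips     = (λ ισ≡σ → sign≢-sign σ (trans (sym (cong sign ισ≡σ)) flips)) , flips

open import Data.Integer using (+_; +≤+; _≤_)

theorem2p7 : ∀ {c ℓ₁ ℓ₂ : Level} (n : ℕ) (L : LabeledPoset n c ℓ₁ ℓ₂)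
    → NaturallyLabeled L → (α : Composition n)
    → (signedSum L α ≡ + length (𝓛⋆α L α)) × (+ 0 ≤ signedSum L α)
theorem2p7 n L natural α = signedSum≡#𝓛⋆α , subst (+ 0 ≤_) (sym signedSum≡#𝓛⋆α) (+≤+ z≤n)
  where
    open Involution L natural α using (sign; starred; ι; 𝓛α-unique; isSignReversing)
    open SignReversingInvolution (≡-dec _≟ᶠ_) sign starred ι using (Σsign≡#fixed)

    signedSum≡#𝓛⋆α : signedSum L α ≡ + length (𝓛⋆α L α)
    signedSum≡#𝓛⋆α = Σsign≡#fixed (𝓛α L α) 𝓛α-unique isSignReversing
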